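{- Let $\mathcal{L}$ be either a logic $\mathsf{M}\mathcal{A}$ with $\mathcal{A}\subseteq\{\mathsf N,\mathsf C,\mathsf P,\mathsf D,\mathsf 4\}$, or one of $\mathsf{M5},\mathsf{MP5},\mathsf{M45},\mathsf{MP45},\mathsf{MD45},\mathsf{K45},\mathsf{KD45}$. Then every derivation in the sequent calculus $\mathsf{G}_{\mathcal{L}}$ extended with contraction, weakening and the multicut rule can be converted into a derivation in $\mathsf{G}_{\mathcal{L}}$ extended with contraction and weakening (without multicut) with the same endsequent.
   Context: Formulas: propositional variables, $\bot,\top,\neg,\land,\lor,\to,\Box$; sequents $\Gamma\Rightarrow\Delta$ are pairs of finite multisets; $\Box\Gamma=\{\Box B:B\in\Gamma\}$, $A^n$ is $n$ copies of $A$. Logics: for a set $\mathcal{A}$ of axiom names, $\mathsf{M}\mathcal{A}$ is the smallest set containing propositional tautologies, $\Box(A\land B)\to(\Box A\land\Box B)$ and the axioms in $\mathcal{A}$ ($\mathsf C: (\Box A\land\Box B)\to\Box(A\land B)$, $\mathsf N: \Box\top$, $\mathsf P: \neg\Box\bot$, $\mathsf D: \neg(\Box A\land\Box\neg A)$, $\mathsf 4: \Box A\to\Box\Box A$, $\mathsf 5: \Box A\lor\Box\neg\Box A$), closed under modus ponens and from $A\to B$, $B\to A$ infer $\Box A\to\Box B$. $\mathsf{M5}=\mathsf M\{\mathsf5\}$, $\mathsf{MP5}=\mathsf M\{\mathsf P,\mathsf5\}$, $\mathsf{M45}=\mathsf M\{\mathsf4,\mathsf5\}$, $\mathsf{MP45}=\mathsf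 M\{\mathsf P,\mathsf4,\mathsf5\}$, $\mathsf{MD45}=\mathsf M\{\mathsf D,\mathsf4,\mathsf5\}$, $\mathsf{K45}=\mathsf M\{\mathsf C,\mathsf N,\mathsf4,\mathsf5\}$, $\mathsf{KD45}=\mathsf M\{\mathsf C,\mathsf N,\mathsf D,\mathsf4,\mathsf5\}$. Propositional calculus $\mathsf G$: initial sequents $\Gamma,p\Rightarrow p,\Delta$ ($p$ atomic), $\Gamma,\bot\Rightarrow\Delta$, $\Gamma\Rightarrow\top,\Delta$, and the standard two-sided invertible rules for $\neg,\land,\lor,\to$ with contexts. Modal sequent rules (no extra context in conclusions unless shown): $\mathsf M$: $A\Rightarrow B$ / $\Box A\Rightarrow\Box B$; $\mathsf N$: $\Rightarrow A$ / $\Rightarrow\Box A$; $\mathsf P$: $A\Rightarrow$ / $\Box A\Rightarrow$; $\mathsf D$: $A,B\Rightarrow$ / $\Box A,\Box B\Rightarrow$; $\mathsf T$: $\Gamma,A\Rightarrow\Delta$ / $\Gamma,\Box A\Rightarrow\Delta$; $\mathsf 4$: $\Box A\Rightarrow B$ / $\Box A\Rightarrow\Box B$; $\mathsf 5$: $\Rightarrow A,\Box B$ / $\Rightarrow\Box A,\Box B$; $\mathsf{D4}$: $A,\Box B\Rightarrow$ / $\Box A,\Box B\Rightarrow$; $\mathsf{D5}$: $A\Rightarrow\Box B$ / $\Box A\Rightarrow\Box B$; $\mathsf C$: $\Gamma\Rightarrow A$ / $\Box\Gamma\Rightarrow\Box A$ ($|\Gamma|\geq1$); $\mathsf{CD}$: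 $\Gamma\Rightarrow$ / $\Box\Gamma\Rightarrow$; $\mathsf{C4}$: $\Box\Gamma,\Sigma\Rightarrow B$ / $\Box\Gamma,\Box\Sigma\Rightarrow\Box B$ ($|\Gamma,\Sigma|\geq1$); $\mathsf{CD4}$: $\Box\Gamma,\Sigma\Rightarrow$ / $\Box\Gamma,\Box\Sigma\Rightarrow$; $\mathsf{K4}$: $\Box\Gamma,\Sigma\Rightarrow A$ / $\Box\Gamma,\Box\Sigma\Rightarrow\Box A$; $\mathsf{K45}$: $\Box\Gamma,\Sigma\Rightarrow A,\Box\Delta$ / $\Box\Gamma,\Box\Sigma\Rightarrow\Box A,\Box\Delta$; $\mathsf{KD45}$: $\Box\Gamma,\Sigma\Rightarrow\Box\Delta$ / $\Box\Gamma,\Box\Sigma\Rightarrow\Box\Delta$. Calculi: for $\mathcal{A}\subseteq\{\mathsf N,\mathsf P,\mathsf D,\mathsf T,\mathsf 4,\mathsf 5\}$, $\mathsf G_{\mathsf M\mathcal A}$ is $\mathsf G$ plus the rules $\{\mathsf M\}\cup\mathcal A$, plus $\mathsf{D4}$ if $\{\mathsf D,\mathsf4\}\subseteq\mathcal A$, plus $\mathsf{D5}$ if $\{\mathsf D,\mathsf5\}\subseteq\mathcal A$. The calculus for $\mathsf M(\{\mathsf C\}\cup\mathcal A)$ is $\mathsf G$ plus the rules $\{\mathsf C\}\cup\mathcal A$, plus $\mathsf{CD}$ if $\mathsf P\in\mathcal A$ or $\mathsf D\in\mathcal A$; $\mathsf{C4}$ if $\mathsf 4\in\mathcal A$; $\mathsf{CD4}$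 if $\{\mathsf P,\mathsf4\}\subseteq\mathcal A$ or $\{\mathsf D,\mathsf4\}\subseteq\mathcal A$; $\mathsf{K4}$ if $\{\mathsf N,\mathsf4\}\subseteq\mathcal A$; $\mathsf{K45}$ if $\{\mathsf N,\mathsf4,\mathsf5\}\subseteq\mathcal A$; $\mathsf{KD45}$ if $\{\mathsf N,\mathsf P,\mathsf4,\mathsf5\}\subseteq\mathcal A$ or $\{\mathsf N,\mathsf D,\mathsf4,\mathsf5\}\subseteq\mathcal A$. Contraction and weakening are the usual left/right structural rules. Multicut: from $\Gamma\Rightarrow\Delta,A^n$ and $A^m,\Sigma\Rightarrow\Pi$ ($n,m\geq1$) infer $\Gamma,\Sigma\Rightarrow\Delta,\Pi$. -}

module Defs where

open import Data.Nat using (ℕ; suc; _<_; _+_)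
open import Data.Bool using (Bool; true; false; _∧_; _∨_; T)
open import Data.List using (List; []; _∷_; _++_; map; replicate; length)
open import Data.List.Relation.Binary.Permutation.Propositional using (_↭_)

infixr 8 _∧'_
infixr 7 _∨'_
infixr 6 _⇒'_

data Fm : Set where
  var  : ℕ → Fm
  ⊥'   : Fm
  ⊤'   : Fm
  ¬'_  : Fm → Fm
  _∧'_ : Fm → Fm → Fm
  _∨'_ : Fm → Fm → Fm
  _⇒'_ : Fm → Fm → Fm
  □_   : Fm → Fm

□* : List Fm → List Fm
□* = map □_

-- Sequents: pairs of finite multisets, represented as lists; multiset
-- identity is realised by the (implicit) exchange rule `exch` below.

infix 3 _⟹_
record Sequent : Set where
  constructor _⟹_
  field
    ante : List Fm
    succ : List Fm
open Sequent public

record Rules : Set where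
  field
    rM rN rP rD rT r4 r5 rD4 rD5 rC rCD rC4 rCD4 rK4 rK45 rKD45 : Bool
open Rules public

record Axioms : Set where
  constructor axioms
  field
    aN aC aP aD aT a4 a5 : Bool
open Axioms public

calculus : Axioms → Rules
calculus (axioms n false p d t f4 f5) = record
  { rM = true ; rN = n ; rP = p ; rD = d ; rT = t ; r4 = f4 ; r5 = f5
  ; rD4 = d ∧ f4 ; rD5 = d ∧ f5
  ; rC = false ; rCD = false ; rC4 = false ; rCD4 = false
  ; rK4 = false ; rK45 = false ; rKD45 = false }
calculus (axioms n true p d t f4 f5) = record
  { rM = false ; rN = n ; rP = p ; rD = d ; rT = t ; r4 = f4 ; r5 = f5
  ; rD4 = false ; rD5 = false
  ; rC = true ; rCD = p ∨ d ; rC4 = f4 ; rCD4 = (p ∨ d) ∧ f4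
  ; rK4 = n ∧ f4 ; rK45 = n ∧ f4 ∧ f5 ; rKD45 = n ∧ f4 ∧ f5 ∧ (p ∨ d) }

data Logic : Set where
  M𝒜 : (n c p d f4 : Bool) → Logic
  M5 MP5 M45 MP45 MD45 K45 KD45 : Logic

axiomsOf : Logic → Axioms
axiomsOf (M𝒜 n c p d f4) = axioms n c p d false f4 false
axiomsOf M5   = axioms false false false false false false true
axiomsOf MP5  = axioms false false true  false false false true
axiomsOf M45  = axioms false false false false false true  true
axiomsOf MP45 = axioms false false true  false false true  true
axiomsOf MD45 = axioms false false false true  false true  true
axiomsOf K45  = axioms true  true  false false false true  true
axiomsOf KD45 = axioms true  true  false true  false true  true

G : Logic → Rules
G L = calculus (axiomsOf L)

infix 2 Der
data Der (R : Rules) (cut : Bool) : Sequent → Set where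
  exch : ∀ {Γ Γ' Δ Δ'} → Γ ↭ Γ' → Δ ↭ Δ' →
         Der R cut (Γ ⟹ Δ) → Der R cut (Γ' ⟹ Δ')
  ax   : ∀ {Γ Δ} p → Der R cut (var p ∷ Γ ⟹ var p ∷ Δ)
  ⊥L   : ∀ {Γ Δ} → Der R cut (⊥' ∷ Γ ⟹ Δ)
  ⊤R   : ∀ {Γ Δ} → Der R cut (Γ ⟹ ⊤' ∷ Δ)
  ¬L   : ∀ {Γ Δ A} → Der R cut (Γ ⟹ A ∷ Δ) → Der R cut (¬' A ∷ Γ ⟹ Δ)
  ¬R   : ∀ {Γ Δ A} → Der R cut (A ∷ Γ ⟹ Δ) → Der R cut (Γ ⟹ ¬' A ∷ Δ)
  ∧L   : ∀ {Γ Δ A B} → Der R cut (A ∷ B ∷ Γ ⟹ Δ) → Der R cut (A ∧' B ∷ Γ ⟹ Δ)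
  ∧R   : ∀ {Γ Δ A B} → Der R cut (Γ ⟹ A ∷ Δ) → Der R cut (Γ ⟹ B ∷ Δ) →
         Der R cut (Γ ⟹ A ∧' B ∷ Δ)
  ∨L   : ∀ {Γ Δ A B} → Der R cut (A ∷ Γ ⟹ Δ) → Der R cut (B ∷ Γ ⟹ Δ) →
         Der R cut (A ∨' B ∷ Γ ⟹ Δ)
  ∨R   : ∀ {Γ Δ A B} → Der R cut (Γ ⟹ A ∷ B ∷ Δ) → Der R cut (Γ ⟹ A ∨' B ∷ Δ)
  ⇒L   : ∀ {Γ Δ A B} → Der R cut (Γ ⟹ A ∷ Δ) → Der R cut (B ∷ Γ ⟹ Δ) →
         Der R cut (A ⇒' B ∷ Γ ⟹ Δ)
  ⇒R   : ∀ {Γ Δ A B} → Der R cut (A ∷ Γ ⟹ B ∷ Δ) → Der R cut (Γ ⟹ A ⇒' B ∷ Δ)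
  wL   : ∀ {Γ Δ A} → Der R cut (Γ ⟹ Δ) → Der R cut (A ∷ Γ ⟹ Δ)
  wR   : ∀ {Γ Δ A} → Der R cut (Γ ⟹ Δ) → Der R cut (Γ ⟹ A ∷ Δ)
  cL   : ∀ {Γ Δ A} → Der R cut (A ∷ A ∷ Γ ⟹ Δ) → Der R cut (A ∷ Γ ⟹ Δ)
  cR   : ∀ {Γ Δ A} → Der R cut (Γ ⟹ A ∷ A ∷ Δ) → Der R cut (Γ ⟹ A ∷ Δ)
  mcut : ∀ {Γ Δ Σ Π A} n m → T cut →
         Der R cut (Γ ⟹ Δ ++ replicate (suc n) A) →
         Der R cut (replicate (suc m) A ++ Σ ⟹ Π) →
         Der R cut (Γ ++ Σ ⟹ Δ ++ Π)
  M    : ∀ {A B} → T (rM R) → Der R cut (A ∷ [] ⟹ B ∷ []) →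
         Der R cut (□ A ∷ [] ⟹ □ B ∷ [])
  N    : ∀ {A} → T (rN R) → Der R cut ([] ⟹ A ∷ []) → Der R cut ([] ⟹ □ A ∷ [])
  P    : ∀ {A} → T (rP R) → Der R cut (A ∷ [] ⟹ []) → Der R cut (□ A ∷ [] ⟹ [])
  D    : ∀ {A B} → T (rD R) → Der R cut (A ∷ B ∷ [] ⟹ []) →
         Der R cut (□ A ∷ □ B ∷ [] ⟹ [])
  Tr   : ∀ {Γ Δ A} → T (rT R) → Der R cut (A ∷ Γ ⟹ Δ) → Der R cut (□ A ∷ Γ ⟹ Δ)
  R4   : ∀ {A B} → T (r4 R) → Der R cut (□ A ∷ [] ⟹ B ∷ []) →
         Der R cut (□ A ∷ [] ⟹ □ B ∷ [])
  R5   : ∀ {A B} → T (r5 R) → Der R cut ([] ⟹ A ∷ □ B ∷ []) →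
         Der R cut ([] ⟹ □ A ∷ □ B ∷ [])
  RD4  : ∀ {A B} → T (rD4 R) → Der R cut (A ∷ □ B ∷ [] ⟹ []) →
         Der R cut (□ A ∷ □ B ∷ [] ⟹ [])
  RD5  : ∀ {A B} → T (rD5 R) → Der R cut (A ∷ [] ⟹ □ B ∷ []) →
         Der R cut (□ A ∷ [] ⟹ □ B ∷ [])
  C    : ∀ {Γ A} → T (rC R) → 1 Data.Nat.≤ length Γ → Der R cut (Γ ⟹ A ∷ []) →
         Der R cut (□* Γ ⟹ □ A ∷ [])
  CD   : ∀ {Γ} → T (rCD R) → Der R cut (Γ ⟹ []) → Der R cut (□* Γ ⟹ [])
  C4   : ∀ {Γ Σ B} → T (rC4 R) → 1 Data.Nat.≤ length Γ + length Σ →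
         Der R cut (□* Γ ++ Σ ⟹ B ∷ []) → Der R cut (□* Γ ++ □* Σ ⟹ □ B ∷ [])
  CD4  : ∀ {Γ Σ} → T (rCD4 R) →
         Der R cut (□* Γ ++ Σ ⟹ []) → Der R cut (□* Γ ++ □* Σ ⟹ [])
  K4   : ∀ {Γ Σ A} → T (rK4 R) →
         Der R cut (□* Γ ++ Σ ⟹ A ∷ []) → Der R cut (□* Γ ++ □* Σ ⟹ □ A ∷ [])
  K45  : ∀ {Γ Σ Δ A} → T (rK45 R) →
         Der R cut (□* Γ ++ Σ ⟹ A ∷ □* Δ) → Der R cut (□* Γ ++ □* Σ ⟹ □ A ∷ □* Δ)
  KD45 : ∀ {Γ Σ Δ} → T (rKD45 R) →
         Der R cut (□* Γ ++ Σ ⟹ □* Δ) → Der R cut (□* Γ ++ □* Σ ⟹ □* Δ)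

-- Gentzen's mix elimination, made uniform over the calculi. Every modal rule of these
-- calculi is an instance of one generic rule  □Γ, Σ ⟹ Π, □Δ / □Γ, □Σ ⟹ □Π, □Δ  whose
-- availability depends only on the lengths of Γ, Σ, Π, Δ. Mix on A (deleting every
-- occurrence of A from the succedent of the left and the antecedent of the right premise)
-- is admissible by induction on A, then on the left and on the right derivation. The only
-- case specific to the calculus is a mix on □B between two modal rules: it reduces to
-- mixes on B and on □B with the premises, and the resulting sequent is again the
-- conclusion of an instance of the generic rule. That this instance is available is a
-- finite check on lengths: by enumerating the eight rules for the calculi without C, and,
-- for those with C, by a few constraints characterising the available lengths.

module Submission where

open import Defs
open import Data.Bool using (Bool; true; false; T; _∧_; _∨_)
open import Data.Bool.Properties using (T-∧; T-∨)
open import Data.Empty using (⊥-elim)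
open import Data.List using (List; []; _∷_; _++_; map; length; replicate; filter)
open import Data.List.Properties using (length-++; length-filter; filter-notAll; filter-++; map-++)
import Data.List.Relation.Unary.Any as Any
open import Data.List.Relation.Unary.Any using (here; there)
open import Data.List.Membership.Propositional using (_∈_; _∉_)
open import Data.List.Membership.Propositional.Properties
  using (∈-++⁺ˡ; ∈-++⁺ʳ; ∈-++⁻; ∈-map⁺; ∈-map⁻; ∈-∃++; ∈-filter⁺; ∈-filter⁻; ∈-length)
open import Data.List.Relation.Binary.Subset.Propositional using (_⊆_)
open import Data.List.Relation.Binary.Subset.Propositional.Properties
  using (⊆-refl; ⊆-reflexive; ∈-∷⁺ʳ; ∷⁺ʳ; map⁺; ++⁺; ++⁺ˡ; ++⁺ʳ)
open import Data.List.Relation.Binary.Permutation.Propositional using (_↭_; ↭-refl; ↭-sym; prep; swap)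
open import Data.List.Relation.Binary.Permutation.Propositional.Properties using (∈-resp-↭; shift; ++-comm)
import Data.Nat as ℕ
open import Data.Nat using (ℕ; zero; suc; _+_; _≤_; _<_; z≤n; s≤s)
open import Data.Nat.Properties
  using (≤-trans; ≤-antisym; <-irrefl; ≤-<-trans; <-≤-trans; m<n⇒0<n; m+n≡0⇒m≡0; m+n≡0⇒n≡0; +-mono-<-≤; +-mono-≤-<)
open import Data.Product using (Σ; _×_; _,_; proj₁; proj₂; uncurry)
open import Data.Sum using (_⊎_; inj₁; inj₂; [_,_])
open import Data.Unit using (⊤; tt)
open import Function using (_∘_; case_of_)
open import Function.Bundles using (Equivalence)
open import Relation.Binary.Definitions using (DecidableEquality)
open import Relation.Binary.PropositionalEquality using (_≡_; _≢_; refl; sym; trans; cong; subst)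
open import Relation.Nullary using (yes; no; ¬_; ¬?)

infix 4 _≟_
_≟_ : DecidableEquality Fm
var a ≟ var b with a ℕ.≟ b
... | yes refl = yes refl
... | no a≢b = no λ { refl → a≢b refl }
var _ ≟ ⊥' = no λ ()
var _ ≟ ⊤' = no λ ()
var _ ≟ ¬' _ = no λ ()
var _ ≟ _ ∧' _ = no λ ()
var _ ≟ _ ∨' _ = no λ ()
var _ ≟ _ ⇒' _ = no λ ()
var _ ≟ □ _ = no λ ()
⊥' ≟ var _ = no λ ()
⊥' ≟ ⊥' = yes refl
⊥' ≟ ⊤' = no λ ()
⊥' ≟ ¬' _ = no λ ()
⊥' ≟ _ ∧' _ = no λ ()
⊥' ≟ _ ∨' _ = no λ ()
⊥' ≟ _ ⇒' _ = no λ ()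
⊥' ≟ □ _ = no λ ()
⊤' ≟ var _ = no λ ()
⊤' ≟ ⊥' = no λ ()
⊤' ≟ ⊤' = yes refl
⊤' ≟ ¬' _ = no λ ()
⊤' ≟ _ ∧' _ = no λ ()
⊤' ≟ _ ∨' _ = no λ ()
⊤' ≟ _ ⇒' _ = no λ ()
⊤' ≟ □ _ = no λ ()
¬' _ ≟ var _ = no λ ()
¬' _ ≟ ⊥' = no λ ()
¬' _ ≟ ⊤' = no λ ()
¬' a ≟ ¬' b with a ≟ b
... | yes refl = yes refl
... | no a≢b = no λ { refl → a≢b refl }
¬' _ ≟ _ ∧' _ = no λ ()
¬' _ ≟ _ ∨' _ = no λ ()
¬' _ ≟ _ ⇒' _ = no λ ()
¬' _ ≟ □ _ = no λ ()
_ ∧' _ ≟ var _ = no λ ()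
_ ∧' _ ≟ ⊥' = no λ ()
_ ∧' _ ≟ ⊤' = no λ ()
_ ∧' _ ≟ ¬' _ = no λ ()
a ∧' b ≟ c ∧' d with a ≟ c | b ≟ d
... | yes refl | yes refl = yes refl
... | no a≢c | _ = no λ { refl → a≢c refl }
... | _ | no b≢d = no λ { refl → b≢d refl }
_ ∧' _ ≟ _ ∨' _ = no λ ()
_ ∧' _ ≟ _ ⇒' _ = no λ ()
_ ∧' _ ≟ □ _ = no λ ()
_ ∨' _ ≟ var _ = no λ ()
_ ∨' _ ≟ ⊥' = no λ ()
_ ∨' _ ≟ ⊤' = no λ ()
_ ∨' _ ≟ ¬' _ = no λ ()
_ ∨' _ ≟ _ ∧' _ = no λ ()
a ∨' b ≟ c ∨' d with a ≟ c | b ≟ d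
... | yes refl | yes refl = yes refl
... | no a≢c | _ = no λ { refl → a≢c refl }
... | _ | no b≢d = no λ { refl → b≢d refl }
_ ∨' _ ≟ _ ⇒' _ = no λ ()
_ ∨' _ ≟ □ _ = no λ ()
_ ⇒' _ ≟ var _ = no λ ()
_ ⇒' _ ≟ ⊥' = no λ ()
_ ⇒' _ ≟ ⊤' = no λ ()
_ ⇒' _ ≟ ¬' _ = no λ ()
_ ⇒' _ ≟ _ ∧' _ = no λ ()
_ ⇒' _ ≟ _ ∨' _ = no λ ()
a ⇒' b ≟ c ⇒' d with a ≟ c | b ≟ d
... | yes refl | yes refl = yes refl
... | no a≢c | _ = no λ { refl → a≢c refl }
... | _ | no b≢d = no λ { refl → b≢d refl }
_ ⇒' _ ≟ □ _ = no λ ()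
□ _ ≟ var _ = no λ ()
□ _ ≟ ⊥' = no λ ()
□ _ ≟ ⊤' = no λ ()
□ _ ≟ ¬' _ = no λ ()
□ _ ≟ _ ∧' _ = no λ ()
□ _ ≟ _ ∨' _ = no λ ()
□ _ ≟ _ ⇒' _ = no λ ()
□ a ≟ □ b with a ≟ b
... | yes refl = yes refl
... | no a≢b = no λ { refl → a≢b refl }

open import Data.List.Membership.DecPropositional _≟_ using (_∈?_)

□-injective : ∀ {A B} → □ A ≡ □ B → A ≡ B
□-injective refl = refl

data NonModal : Fm → Set where
  var : ∀ {n} → NonModal (var n)
  bot : NonModal ⊥'
  top : NonModal ⊤'
  neg : ∀ {a} → NonModal (¬' a)
  and : ∀ {a b} → NonModal (a ∧' b)
  or  : ∀ {a b} → NonModal (a ∨' b)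
  imp : ∀ {a b} → NonModal (a ⇒' b)

data BoxView : Fm → Set where
  boxed    : ∀ B → BoxView (□ B)
  nonModal : ∀ {A} → NonModal A → BoxView A

boxView : ∀ A → BoxView A
boxView (var _)  = nonModal var
boxView ⊥'       = nonModal bot
boxView ⊤'       = nonModal top
boxView (¬' _)   = nonModal neg
boxView (_ ∧' _) = nonModal and
boxView (_ ∨' _) = nonModal or
boxView (_ ⇒' _) = nonModal imp
boxView (□ B)    = boxed B

++-lub : ∀ {xs ys zs : List Fm} → xs ⊆ zs → ys ⊆ zs → xs ++ ys ⊆ zs
++-lub {xs} f g m = [ f , g ] (∈-++⁻ xs m)

∷-++-⊆ : ∀ {x : Fm} xs {ys} → x ∷ xs ++ ys ⊆ xs ++ x ∷ ys
∷-++-⊆ {x} xs {ys} = ∈-resp-↭ (↭-sym (shift x xs ys))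

++-∷-⊆ : ∀ {x : Fm} xs {ys} → xs ++ x ∷ ys ⊆ x ∷ xs ++ ys
++-∷-⊆ {x} xs {ys} = ∈-resp-↭ (shift x xs ys)

∈-++-∉ʳ : ∀ {B : Fm} xs {ys} → B ∈ xs ++ ys → B ∉ ys → B ∈ xs
∈-++-∉ʳ xs m B∉ys = [ (λ m → m) , (λ m → ⊥-elim (B∉ys m)) ] (∈-++⁻ xs m)

∈-++-∉ˡ : ∀ {B : Fm} xs {ys} → B ∈ xs ++ ys → B ∉ xs → B ∈ ys
∈-++-∉ˡ xs m B∉xs = [ (λ m → ⊥-elim (B∉xs m)) , (λ m → m) ] (∈-++⁻ xs m)

∈-□*⁻ : ∀ {B xs} → □ B ∈ □* xs → B ∈ xs
∈-□*⁻ m with ∈-map⁻ □_ m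
... | _ , m′ , refl = m′

∈-□*-++⁻ : ∀ {B} xs {ys} → □ B ∈ □* xs ++ □* ys → B ∈ xs ++ ys
∈-□*-++⁻ xs m = [ ∈-++⁺ˡ ∘ ∈-□*⁻ , ∈-++⁺ʳ xs ∘ ∈-□*⁻ ] (∈-++⁻ (□* xs) m)

∉-□* : ∀ {A xs} → NonModal A → A ∉ □* xs
∉-□* nm m with ∈-map⁻ □_ m
∉-□* () m | _ , _ , refl

∉-□*-++ : ∀ {A} xs {ys} → NonModal A → A ∉ □* xs ++ □* ys
∉-□*-++ xs nm m = [ ∉-□* nm , ∉-□* nm ] (∈-++⁻ (□* xs) m)

replicate-⊆ : ∀ {A : Fm} k {ys} → replicate k A ⊆ A ∷ ys
replicate-⊆ (suc k) (here refl) = here refl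
replicate-⊆ (suc k) (there m)   = replicate-⊆ k m

□*-++ : ∀ xs {ys} → □* (xs ++ ys) ⊆ □* xs ++ □* ys
□*-++ xs {ys} = ⊆-reflexive (map-++ □_ xs ys)

□*-++⁻ : ∀ xs {ys} → □* xs ++ □* ys ⊆ □* (xs ++ ys)
□*-++⁻ xs {ys} = ⊆-reflexive (sym (map-++ □_ xs ys))

infixl 6 _∖_
_∖_ : List Fm → Fm → List Fm
xs ∖ A = filter (λ x → ¬? (A ≟ x)) xs

module _ {A : Fm} where

  ∖-⊆ : ∀ xs → xs ∖ A ⊆ xs
  ∖-⊆ xs = proj₁ ∘ ∈-filter⁻ (λ x → ¬? (A ≟ x)) {xs = xs}

  ∈-∖⇒≢ : ∀ {y} xs → y ∈ xs ∖ A → y ≢ A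
  ∈-∖⇒≢ xs m y≡A = proj₂ (∈-filter⁻ (λ x → ¬? (A ≟ x)) {xs = xs} m) (sym y≡A)

  ∈-∖⁺ : ∀ {y} xs → y ∈ xs → y ≢ A → y ∈ xs ∖ A
  ∈-∖⁺ xs m y≢A = ∈-filter⁺ (λ x → ¬? (A ≟ x)) m (y≢A ∘ sym)

  ∖-++ : ∀ xs {ys} → (xs ++ ys) ∖ A ≡ xs ∖ A ++ ys ∖ A
  ∖-++ xs {ys} = filter-++ (λ x → ¬? (A ≟ x)) xs ys

  ∖-mono : ∀ {xs ys} → xs ⊆ ys → xs ∖ A ⊆ ys ∖ A
  ∖-mono {xs} {ys} f m = ∈-∖⁺ ys (f (∖-⊆ xs m)) (∈-∖⇒≢ xs m)

  ⊆∷∖ : ∀ {xs} → xs ⊆ A ∷ xs ∖ A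
  ⊆∷∖ {xs} {y} m with y ≟ A
  ... | yes refl = here refl
  ... | no y≢A = there (∈-∖⁺ xs m y≢A)

  ⊆∷⇒∖⊆ : ∀ {xs ys} → xs ⊆ A ∷ ys → xs ∖ A ⊆ ys
  ⊆∷⇒∖⊆ {xs} f m with f (∖-⊆ xs m)
  ... | here y≡A = ⊥-elim (∈-∖⇒≢ xs m y≡A)
  ... | there m′ = m′

  ∉⇒⊆∖ : ∀ {xs} → A ∉ xs → xs ⊆ xs ∖ A
  ∉⇒⊆∖ {xs} A∉xs {y} m with y ≟ A
  ... | yes refl = ⊥-elim (A∉xs m)
  ... | no y≢A = ∈-∖⁺ xs m y≢A

  ∈-∷∖ : ∀ {x xs} → x ≢ A → x ∈ (x ∷ xs) ∖ A
  ∈-∷∖ {x} {xs} x≢A = ∈-∖⁺ (x ∷ xs) (here refl) x≢A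

  ∖-∷⊆ : ∀ {x xs} → (x ∷ xs) ∖ A ⊆ x ∷ xs ∖ A
  ∖-∷⊆ {x} {xs} m with ∖-⊆ (x ∷ xs) m
  ... | here y≡x = here y≡x
  ... | there m′ = there (∈-∖⁺ xs m′ (∈-∖⇒≢ (x ∷ xs) m))

  ∖-++⁺ : ∀ {xs ys xs′ ys′} → xs ∖ A ⊆ xs′ → ys ∖ A ⊆ ys′ → (xs ++ ys) ∖ A ⊆ xs′ ++ ys′
  ∖-++⁺ {xs} f g = ++⁺ f g ∘ ⊆-reflexive (∖-++ xs)

  length-∖ : ∀ xs → length (xs ∖ A) ≤ length xs
  length-∖ = length-filter (λ x → ¬? (A ≟ x))

  length-∖-< : ∀ xs → A ∈ xs → length (xs ∖ A) < length xs
  length-∖-< xs m = filter-notAll (λ x → ¬? (A ≟ x)) xs (Any.map (λ A≡x A≢x → A≢x A≡x) m)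

  length-∖-++-< : ∀ xs {ys} → A ∈ xs ++ ys → length (xs ∖ A) + length (ys ∖ A) < length xs + length ys
  length-∖-++-< xs {ys} m =
    [ (λ m → +-mono-<-≤ (length-∖-< xs m) (length-∖ ys)) , (λ m → +-mono-≤-< (length-∖ xs) (length-∖-< ys m)) ]
      (∈-++⁻ xs m)

  ∖-≤1-⊆ : ∀ {xs ys} → length xs ≤ 1 → A ∈ xs → xs ∖ A ⊆ ys
  ∖-≤1-⊆ {x ∷ []} _ (here refl) m with ∖-⊆ (x ∷ []) m
  ... | here refl = ⊥-elim (∈-∖⇒≢ (x ∷ []) m refl)
  ∖-≤1-⊆ {_ ∷ _ ∷ _} (s≤s ()) _

  ∖-∷∷⊆ : ∀ {a b xs} → (a ∷ b ∷ xs) ∖ A ⊆ a ∷ b ∷ xs ∖ A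
  ∖-∷∷⊆ {a} = ∷⁺ʳ a ∖-∷⊆ ∘ ∖-∷⊆

  ∖-++-⊆ˡ : ∀ xs {ys} → (xs ++ ys) ∖ A ⊆ xs ∖ A ++ ys
  ∖-++-⊆ˡ xs {ys} = ∖-++⁺ {xs} ⊆-refl (∖-⊆ ys)

  ∖-++-⊆ʳ : ∀ xs {ys} → (xs ++ ys) ∖ A ⊆ xs ++ ys ∖ A
  ∖-++-⊆ʳ xs {ys} = ∖-++⁺ {xs} (∖-⊆ xs) ⊆-refl

  ∖-replicate-++ : ∀ k xs → (replicate k A ++ xs) ∖ A ⊆ xs
  ∖-replicate-++ k xs = ⊆∷⇒∖⊆ {replicate k A ++ xs} (++-lub (replicate-⊆ k) there)

  ∖-++-replicate : ∀ xs k → (xs ++ replicate k A) ∖ A ⊆ xs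
  ∖-++-replicate xs k = ⊆∷⇒∖⊆ {xs ++ replicate k A} (++-lub {xs = xs} there (replicate-⊆ k))

∖□ : ∀ {B} xs → □* xs ∖ □ B ⊆ □* (xs ∖ B)
∖□ {B} xs m with ∈-map⁻ □_ (∖-⊆ (□* xs) m)
... | y , y∈xs , refl = ∈-map⁺ □_ (∈-∖⁺ xs y∈xs (∈-∖⇒≢ (□* xs) m ∘ cong □_))

∖□⁻ : ∀ {B} xs → □* (xs ∖ B) ⊆ □* xs ∖ □ B
∖□⁻ {B} xs m with ∈-map⁻ □_ m
... | y , y∈xs∖B , refl = ∈-∖⁺ (□* xs) (∈-map⁺ □_ (∖-⊆ xs y∈xs∖B)) (∈-∖⇒≢ xs y∈xs∖B ∘ □-injective)

∖□-++□ : ∀ {B} xs {ys} → (□* xs ++ □* ys) ∖ □ B ⊆ □* (xs ∖ B) ++ □* (ys ∖ B)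
∖□-++□ xs {ys} = ∖-++⁺ {xs = □* xs} (∖□ xs) (∖□ ys)

∖□-++ : ∀ {B} xs {ys} → (□* xs ++ ys) ∖ □ B ⊆ □* (xs ∖ B) ++ ys
∖□-++ xs {ys} = ∖-++⁺ {xs = □* xs} (∖□ xs) (∖-⊆ ys)

∖-++□ : ∀ {B} xs {ys} → (xs ++ □* ys) ∖ □ B ⊆ xs ++ □* (ys ∖ B)
∖-++□ xs {ys} = ∖-++⁺ {xs = xs} (∖-⊆ xs) (∖□ ys)

-- Shape R g s p d: the calculus R has a modal rule
--   □Γ, Σ ⟹ Π, □Δ  /  □Γ, □Σ ⟹ □Π, □Δ   with |Γ| = g, |Σ| = s, |Π| = p, |Δ| = d.
data Shape (R : Rules) : ℕ → ℕ → ℕ → ℕ → Set where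
  M    : T (rM R) → Shape R 0 1 1 0
  N    : T (rN R) → Shape R 0 0 1 0
  P    : T (rP R) → Shape R 0 1 0 0
  D    : T (rD R) → Shape R 0 2 0 0
  R4   : T (r4 R) → Shape R 1 0 1 0
  R5   : T (r5 R) → Shape R 0 0 1 1
  RD4  : T (rD4 R) → Shape R 1 1 0 0
  RD5  : T (rD5 R) → Shape R 0 1 0 1
  C    : ∀ {s} → T (rC R) → Shape R 0 (suc s) 1 0
  CD   : ∀ {s} → T (rCD R) → Shape R 0 s 0 0
  C4   : ∀ {g s} → T (rC4 R) → 1 ≤ g + s → Shape R g s 1 0
  CD4  : ∀ {g s} → T (rCD4 R) → Shape R g s 0 0
  K4   : ∀ {g s} → T (rK4 R) → Shape R g s 1 0
  K45  : ∀ {g s d} → T (rK45 R) → Shape R g s 1 d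
  KD45 : ∀ {g s d} → T (rKD45 R) → Shape R g s 0 d

Shape-p≤1 : ∀ {R g s p d} → Shape R g s p d → p ≤ 1
Shape-p≤1 (M _)    = s≤s z≤n
Shape-p≤1 (N _)    = s≤s z≤n
Shape-p≤1 (P _)    = z≤n
Shape-p≤1 (D _)    = z≤n
Shape-p≤1 (R4 _)   = s≤s z≤n
Shape-p≤1 (R5 _)   = s≤s z≤n
Shape-p≤1 (RD4 _)  = z≤n
Shape-p≤1 (RD5 _)  = z≤n
Shape-p≤1 (C _)    = s≤s z≤n
Shape-p≤1 (CD _)   = z≤n
Shape-p≤1 (C4 _ _) = s≤s z≤n
Shape-p≤1 (CD4 _)  = z≤n
Shape-p≤1 (K4 _)   = s≤s z≤n
Shape-p≤1 (K45 _)  = s≤s z≤n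
Shape-p≤1 (KD45 _) = z≤n

-- Instances of the generic rule that are derivable: the trivial one, and N and P
-- as the 5- and D-rules with both formulas equal.
data Admissible (R : Rules) : ℕ → ℕ → ℕ → ℕ → Set where
  rule     : ∀ {g s p d} → Shape R g s p d → Admissible R g s p d
  identity : ∀ {g d} → Admissible R g 0 0 d
  N-by-5   : Shape R 0 0 1 1 → Admissible R 0 0 1 0
  P-by-D   : Shape R 0 2 0 0 → Admissible R 0 1 0 0

length≡0 : ∀ {xs : List Fm} → length xs ≡ 0 → xs ≡ []
length≡0 {[]} _ = refl

length≡1 : ∀ {xs : List Fm} → length xs ≡ 1 → Σ Fm λ x → xs ≡ x ∷ []
length≡1 {x ∷ []} _ = x , refl

length≡2 : ∀ {xs : List Fm} → length xs ≡ 2 → Σ Fm λ x → Σ Fm λ y → xs ≡ x ∷ y ∷ []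
length≡2 {x ∷ y ∷ []} _ = x , y , refl

module Calculus (R : Rules) where

  infix 2 ⊢_
  data ⊢_ : Sequent → Set where
    exch : ∀ {Γ Γ' Δ Δ'} → Γ ↭ Γ' → Δ ↭ Δ' → ⊢ Γ ⟹ Δ → ⊢ Γ' ⟹ Δ'
    ax   : ∀ {Γ Δ} p → ⊢ var p ∷ Γ ⟹ var p ∷ Δ
    ⊥L   : ∀ {Γ Δ} → ⊢ ⊥' ∷ Γ ⟹ Δ
    ⊤R   : ∀ {Γ Δ} → ⊢ Γ ⟹ ⊤' ∷ Δ
    ¬L   : ∀ {Γ Δ a} → ⊢ Γ ⟹ a ∷ Δ → ⊢ ¬' a ∷ Γ ⟹ Δ
    ¬R   : ∀ {Γ Δ a} → ⊢ a ∷ Γ ⟹ Δ → ⊢ Γ ⟹ ¬' a ∷ Δ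
    ∧L   : ∀ {Γ Δ a b} → ⊢ a ∷ b ∷ Γ ⟹ Δ → ⊢ a ∧' b ∷ Γ ⟹ Δ
    ∧R   : ∀ {Γ Δ a b} → ⊢ Γ ⟹ a ∷ Δ → ⊢ Γ ⟹ b ∷ Δ → ⊢ Γ ⟹ a ∧' b ∷ Δ
    ∨L   : ∀ {Γ Δ a b} → ⊢ a ∷ Γ ⟹ Δ → ⊢ b ∷ Γ ⟹ Δ → ⊢ a ∨' b ∷ Γ ⟹ Δ
    ∨R   : ∀ {Γ Δ a b} → ⊢ Γ ⟹ a ∷ b ∷ Δ → ⊢ Γ ⟹ a ∨' b ∷ Δ
    ⇒L   : ∀ {Γ Δ a b} → ⊢ Γ ⟹ a ∷ Δ → ⊢ b ∷ Γ ⟹ Δ → ⊢ a ⇒' b ∷ Γ ⟹ Δ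
    ⇒R   : ∀ {Γ Δ a b} → ⊢ a ∷ Γ ⟹ b ∷ Δ → ⊢ Γ ⟹ a ⇒' b ∷ Δ
    wL   : ∀ {Γ Δ a} → ⊢ Γ ⟹ Δ → ⊢ a ∷ Γ ⟹ Δ
    wR   : ∀ {Γ Δ a} → ⊢ Γ ⟹ Δ → ⊢ Γ ⟹ a ∷ Δ
    cL   : ∀ {Γ Δ a} → ⊢ a ∷ a ∷ Γ ⟹ Δ → ⊢ a ∷ Γ ⟹ Δ
    cR   : ∀ {Γ Δ a} → ⊢ Γ ⟹ a ∷ a ∷ Δ → ⊢ Γ ⟹ a ∷ Δ
    mod  : ∀ {Γ Σ Π Δ} → Shape R (length Γ) (length Σ) (length Π) (length Δ) →
           ⊢ □* Γ ++ Σ ⟹ Π ++ □* Δ → ⊢ □* Γ ++ □* Σ ⟹ □* Π ++ □* Δ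

  weakenL : ∀ {Γ Δ} Ξ → ⊢ Γ ⟹ Δ → ⊢ Ξ ++ Γ ⟹ Δ
  weakenL []      d = d
  weakenL (_ ∷ Ξ) d = wL (weakenL Ξ d)

  weakenR : ∀ {Γ Δ} Ξ → ⊢ Γ ⟹ Δ → ⊢ Γ ⟹ Ξ ++ Δ
  weakenR []      d = d
  weakenR (_ ∷ Ξ) d = wR (weakenR Ξ d)

  contractL : ∀ {x Γ Δ} → x ∈ Γ → ⊢ x ∷ Γ ⟹ Δ → ⊢ Γ ⟹ Δ
  contractL {x} m d with ∈-∃++ m
  ... | ys , zs , refl = exch (↭-sym (shift x ys zs)) ↭-refl (cL (exch (prep x (shift x ys zs)) ↭-refl d))

  contractR : ∀ {x Γ Δ} → x ∈ Δ → ⊢ Γ ⟹ x ∷ Δ → ⊢ Γ ⟹ Δ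
  contractR {x} m d with ∈-∃++ m
  ... | ys , zs , refl = exch ↭-refl (↭-sym (shift x ys zs)) (cR (exch ↭-refl (prep x (shift x ys zs)) d))

  absorbL : ∀ Ξ {Γ Δ} → Ξ ⊆ Γ → ⊢ Ξ ++ Γ ⟹ Δ → ⊢ Γ ⟹ Δ
  absorbL []      _ d = d
  absorbL (_ ∷ Ξ) f d = absorbL Ξ (f ∘ there) (contractL (∈-++⁺ʳ Ξ (f (here refl))) d)

  absorbR : ∀ Ξ {Γ Δ} → Ξ ⊆ Δ → ⊢ Γ ⟹ Ξ ++ Δ → ⊢ Γ ⟹ Δ
  absorbR []      _ d = d
  absorbR (_ ∷ Ξ) f d = absorbR Ξ (f ∘ there) (contractR (∈-++⁺ʳ Ξ (f (here refl))) d)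

  ⊢-mono : ∀ {Γ Γ' Δ Δ'} → Γ ⊆ Γ' → Δ ⊆ Δ' → ⊢ Γ ⟹ Δ → ⊢ Γ' ⟹ Δ'
  ⊢-mono {Γ} {Γ'} {Δ} {Δ'} f g d =
    absorbR Δ g (exch ↭-refl (++-comm Δ' Δ)
      (absorbL Γ f (exch (++-comm Γ' Γ) ↭-refl (weakenL Γ' (weakenR Δ' d)))))

  mod-admissible : ∀ {g s p d Γ Σ Π Δ} → Admissible R g s p d →
    length Γ ≡ g → length Σ ≡ s → length Π ≡ p → length Δ ≡ d →
    ⊢ □* Γ ++ Σ ⟹ Π ++ □* Δ → ⊢ □* Γ ++ □* Σ ⟹ □* Π ++ □* Δ
  mod-admissible {Γ = Γ} {Σ} {Π} {Δ} (rule sh) refl refl refl refl d = mod {Γ} {Σ} {Π} {Δ} sh d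
  mod-admissible {Σ = Σ} {Π} identity _ eΣ eΠ _ d with length≡0 {Σ} eΣ | length≡0 {Π} eΠ
  ... | refl | refl = d
  mod-admissible {Γ = Γ} {Σ} {Π} {Δ} (N-by-5 sh) eΓ eΣ eΠ eΔ d
    with length≡0 {Γ} eΓ | length≡0 {Σ} eΣ | length≡1 {Π} eΠ | length≡0 {Δ} eΔ
  ... | refl | refl | A , refl | refl = cR (mod {[]} {[]} {A ∷ []} {A ∷ []} sh (⊢-mono (λ ()) ∈-++⁺ˡ d))
  mod-admissible {Γ = Γ} {Σ} {Π} {Δ} (P-by-D sh) eΓ eΣ eΠ eΔ d
    with length≡0 {Γ} eΓ | length≡1 {Σ} eΣ | length≡0 {Π} eΠ | length≡0 {Δ} eΔ
  ... | refl | A , refl | refl | refl = cL (mod {[]} {A ∷ A ∷ []} {[]} {[]} sh (⊢-mono ∈-++⁺ˡ (λ ()) d))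

  MixableWith : Fm → List Fm → List Fm → Set
  MixableWith A Γ Δ = ∀ {Θ Λ} → ⊢ Θ ⟹ Λ → ⊢ Γ ++ Θ ∖ A ⟹ Δ ∖ A ++ Λ

  Mixable : Fm → Set
  Mixable A = ∀ {Γ Δ} → ⊢ Γ ⟹ Δ → MixableWith A Γ Δ

  cut-by-mix : ∀ {A Γ Δ} → Mixable A → ⊢ Γ ⟹ A ∷ Δ → ⊢ A ∷ Γ ⟹ Δ → ⊢ Γ ⟹ Δ
  cut-by-mix {A} {Γ} {Δ} mix d e =
    ⊢-mono (++-lub ⊆-refl (⊆∷⇒∖⊆ {A} {A ∷ Γ} ⊆-refl)) (++-lub (⊆∷⇒∖⊆ {A} {A ∷ Δ} ⊆-refl) ⊆-refl)
      (mix d e)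

  -- How to mix ⊢ Γ ⟹ Δ into the conclusion of a rule of the right derivation that
  -- introduces A on the left, given the mixes into its premises.
  record Reductions (A : Fm) (Γ Δ : List Fm) : Set where
    field
      ¬-reduction : ∀ {c Θ Λ} → A ≡ ¬' c → ⊢ Θ ⟹ c ∷ Λ →
        ⊢ Γ ++ Θ ∖ A ⟹ Δ ∖ A ++ c ∷ Λ →
        ⊢ Γ ++ (¬' c ∷ Θ) ∖ A ⟹ Δ ∖ A ++ Λ
      ∧-reduction : ∀ {a b Θ Λ} → A ≡ a ∧' b → ⊢ a ∷ b ∷ Θ ⟹ Λ →
        ⊢ Γ ++ (a ∷ b ∷ Θ) ∖ A ⟹ Δ ∖ A ++ Λ →
        ⊢ Γ ++ (a ∧' b ∷ Θ) ∖ A ⟹ Δ ∖ A ++ Λ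
      ∨-reduction : ∀ {a b Θ Λ} → A ≡ a ∨' b → ⊢ a ∷ Θ ⟹ Λ → ⊢ b ∷ Θ ⟹ Λ →
        ⊢ Γ ++ (a ∷ Θ) ∖ A ⟹ Δ ∖ A ++ Λ → ⊢ Γ ++ (b ∷ Θ) ∖ A ⟹ Δ ∖ A ++ Λ →
        ⊢ Γ ++ (a ∨' b ∷ Θ) ∖ A ⟹ Δ ∖ A ++ Λ
      ⇒-reduction : ∀ {a b Θ Λ} → A ≡ a ⇒' b → ⊢ Θ ⟹ a ∷ Λ → ⊢ b ∷ Θ ⟹ Λ →
        ⊢ Γ ++ Θ ∖ A ⟹ Δ ∖ A ++ a ∷ Λ → ⊢ Γ ++ (b ∷ Θ) ∖ A ⟹ Δ ∖ A ++ Λ →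
        ⊢ Γ ++ (a ⇒' b ∷ Θ) ∖ A ⟹ Δ ∖ A ++ Λ
      □-reduction : ∀ {Gs Ss Ps Ds} → A ∈ □* Gs ++ □* Ss →
        Shape R (length Gs) (length Ss) (length Ps) (length Ds) →
        ⊢ □* Gs ++ Ss ⟹ Ps ++ □* Ds →
        ⊢ Γ ++ (□* Gs ++ Ss) ∖ A ⟹ Δ ∖ A ++ Ps ++ □* Ds →
        ⊢ Γ ++ (□* Gs ++ □* Ss) ∖ A ⟹ Δ ∖ A ++ □* Ps ++ □* Ds
  open Reductions

  weaken-∖ˡ : ∀ {A x} Γ {xs} → Γ ++ xs ∖ A ⊆ Γ ++ (x ∷ xs) ∖ A
  weaken-∖ˡ {A} {x} Γ {xs} = ++-lub ∈-++⁺ˡ (∈-++⁺ʳ Γ ∘ ∖-mono {A} {xs} {x ∷ xs} there)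

  push-∖ˡ : ∀ {A x} Γ {xs} → x ≢ A → x ∷ Γ ++ xs ∖ A ⊆ Γ ++ (x ∷ xs) ∖ A
  push-∖ˡ {A} {x} Γ {xs} x≢A = ∈-∷⁺ʳ (∈-++⁺ʳ Γ (∈-∷∖ x≢A)) (weaken-∖ˡ {A} {x} Γ {xs})

  pull-∖ˡ : ∀ {A x} Γ {xs} → Γ ++ (x ∷ xs) ∖ A ⊆ x ∷ Γ ++ xs ∖ A
  pull-∖ˡ {A} {x} Γ {xs} = ++-lub (there ∘ ∈-++⁺ˡ) (∷⁺ʳ x (∈-++⁺ʳ Γ) ∘ ∖-∷⊆ {A} {x} {xs})

  pull-∖ˡ-∷ : ∀ {A x y} Γ {xs} → Γ ++ (x ∷ xs) ∖ A ⊆ x ∷ Γ ++ (y ∷ xs) ∖ A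
  pull-∖ˡ-∷ {A} {x} {y} Γ {xs} = ∷⁺ʳ x (weaken-∖ˡ {A} {y} Γ {xs}) ∘ pull-∖ˡ {A} {x} Γ {xs}

  weaken-∖ʳ : ∀ {A x} Δ {Λ} → Δ ∖ A ++ Λ ⊆ (x ∷ Δ) ∖ A ++ Λ
  weaken-∖ʳ {A} {x} Δ = ++-lub (∈-++⁺ˡ ∘ ∖-mono {A} {Δ} {x ∷ Δ} there) (∈-++⁺ʳ ((x ∷ Δ) ∖ A))

  push-∖ʳ : ∀ {A x} Δ {Λ} → x ≢ A → x ∷ Δ ∖ A ++ Λ ⊆ (x ∷ Δ) ∖ A ++ Λ
  push-∖ʳ Δ x≢A = ∈-∷⁺ʳ (∈-++⁺ˡ (∈-∷∖ x≢A)) (weaken-∖ʳ Δ)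

  pull-∖ʳ : ∀ {A x} Δ {Λ} → (x ∷ Δ) ∖ A ++ Λ ⊆ x ∷ Δ ∖ A ++ Λ
  pull-∖ʳ {A} {x} Δ = ++-lub (∷⁺ʳ x ∈-++⁺ˡ ∘ ∖-∷⊆ {A} {x} {Δ}) (there ∘ ∈-++⁺ʳ (Δ ∖ A))

  pull-∖ʳ-∷ : ∀ {A x y} Δ {Λ} → (x ∷ Δ) ∖ A ++ Λ ⊆ x ∷ (y ∷ Δ) ∖ A ++ Λ
  pull-∖ʳ-∷ {A} {x} {y} Δ = ∷⁺ʳ x (weaken-∖ʳ {A} {y} Δ) ∘ pull-∖ʳ {A} {x} Δ

  module MixRight {A Γ Δ} (A≢⊥ : A ≢ ⊥') (left : ⊢ Γ ⟹ Δ) (red : Reductions A Γ Δ) where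

    mix-right : MixableWith A Γ Δ
    mix-right (exch p q d) =
      ⊢-mono (++-lub ∈-++⁺ˡ (∈-++⁺ʳ Γ ∘ ∖-mono (∈-resp-↭ p))) (++-lub ∈-++⁺ˡ (∈-++⁺ʳ (Δ ∖ A) ∘ ∈-resp-↭ q))
        (mix-right d)
    mix-right (ax p) = case A ≟ var p of λ where
      (yes refl) → ⊢-mono ∈-++⁺ˡ (∈-∷⁺ʳ (∈-++⁺ʳ (Δ ∖ A) (here refl)) ∈-++⁺ˡ ∘ ⊆∷∖ {A} {Δ}) left
      (no A≢p) → ⊢-mono (∈-∷⁺ʳ (∈-++⁺ʳ Γ (∈-∷∖ (A≢p ∘ sym))) (λ ())) (∈-∷⁺ʳ (∈-++⁺ʳ (Δ ∖ A) (here refl)) (λ ()))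
                   (ax {Γ = []} {Δ = []} p)
    mix-right ⊥L = case A ≟ ⊥' of λ where
      (yes A≡⊥) → ⊥-elim (A≢⊥ A≡⊥)
      (no A≢⊥′) → ⊢-mono (∈-∷⁺ʳ (∈-++⁺ʳ Γ (∈-∷∖ (A≢⊥′ ∘ sym))) (λ ())) (λ ()) (⊥L {Γ = []} {Δ = []})
    mix-right ⊤R = ⊢-mono (λ ()) (∈-∷⁺ʳ (∈-++⁺ʳ (Δ ∖ A) (here refl)) (λ ())) (⊤R {Γ = []} {Δ = []})
    mix-right (¬L {a = c} d) = case A ≟ ¬' c of λ where
      (yes A≡¬c) → ¬-reduction red A≡¬c d (mix-right d)
      (no A≢¬c) → ⊢-mono (push-∖ˡ Γ (A≢¬c ∘ sym)) ⊆-refl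
                    (¬L (⊢-mono ⊆-refl (++-∷-⊆ (Δ ∖ A)) (mix-right d)))
    mix-right (¬R {Θ} {a = c} d) =
      ⊢-mono ⊆-refl (∷-++-⊆ (Δ ∖ A)) (¬R (⊢-mono (pull-∖ˡ {A} {c} Γ {Θ}) ⊆-refl (mix-right d)))
    mix-right (∧L {Θ} {a = a} {b} d) = case A ≟ a ∧' b of λ where
      (yes A≡a∧b) → ∧-reduction red A≡a∧b d (mix-right d)
      (no A≢a∧b) → ⊢-mono (push-∖ˡ Γ (A≢a∧b ∘ sym)) ⊆-refl
        (∧L (⊢-mono (∷⁺ʳ a (pull-∖ˡ {A} {b} Γ {Θ}) ∘ pull-∖ˡ {A} {a} Γ {b ∷ Θ}) ⊆-refl (mix-right d)))
    mix-right (∧R d e) =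
      ⊢-mono ⊆-refl (∷-++-⊆ (Δ ∖ A))
        (∧R (⊢-mono ⊆-refl (++-∷-⊆ (Δ ∖ A)) (mix-right d))
            (⊢-mono ⊆-refl (++-∷-⊆ (Δ ∖ A)) (mix-right e)))
    mix-right (∨L {Θ} {a = a} {b} d e) = case A ≟ a ∨' b of λ where
      (yes A≡a∨b) → ∨-reduction red A≡a∨b d e (mix-right d) (mix-right e)
      (no A≢a∨b) → ⊢-mono (push-∖ˡ Γ (A≢a∨b ∘ sym)) ⊆-refl
        (∨L (⊢-mono (pull-∖ˡ {A} {a} Γ {Θ}) ⊆-refl (mix-right d))
            (⊢-mono (pull-∖ˡ {A} {b} Γ {Θ}) ⊆-refl (mix-right e)))
    mix-right (∨R {a = a} {b} d) =
      ⊢-mono ⊆-refl (∷-++-⊆ (Δ ∖ A))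
        (∨R (⊢-mono ⊆-refl (∷⁺ʳ a (++-∷-⊆ (Δ ∖ A)) ∘ ++-∷-⊆ (Δ ∖ A)) (mix-right d)))
    mix-right (⇒L {Θ} {a = a} {b} d e) = case A ≟ a ⇒' b of λ where
      (yes A≡a⇒b) → ⇒-reduction red A≡a⇒b d e (mix-right d) (mix-right e)
      (no A≢a⇒b) → ⊢-mono (push-∖ˡ Γ (A≢a⇒b ∘ sym)) ⊆-refl
        (⇒L (⊢-mono ⊆-refl (++-∷-⊆ (Δ ∖ A)) (mix-right d))
            (⊢-mono (pull-∖ˡ {A} {b} Γ {Θ}) ⊆-refl (mix-right e)))
    mix-right (⇒R {Θ} {a = a} d) =
      ⊢-mono ⊆-refl (∷-++-⊆ (Δ ∖ A))
        (⇒R (⊢-mono (pull-∖ˡ {A} {a} Γ {Θ}) (++-∷-⊆ (Δ ∖ A)) (mix-right d)))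
    mix-right (wL {Θ} {a = a} d) = ⊢-mono (weaken-∖ˡ {A} {a} Γ {Θ}) ⊆-refl (mix-right d)
    mix-right (wR d) = ⊢-mono ⊆-refl (++-lub ∈-++⁺ˡ (∈-++⁺ʳ (Δ ∖ A) ∘ there)) (mix-right d)
    mix-right (cL {Θ} {a = a} d) =
      ⊢-mono (++-lub ∈-++⁺ˡ (∈-++⁺ʳ Γ ∘ ∖-mono {A} {a ∷ a ∷ Θ} {a ∷ Θ} (∈-∷⁺ʳ (here refl) ⊆-refl))) ⊆-refl
        (mix-right d)
    mix-right (cR d) =
      ⊢-mono ⊆-refl (++-lub ∈-++⁺ˡ (∈-++⁺ʳ (Δ ∖ A) ∘ ∈-∷⁺ʳ (here refl) ⊆-refl)) (mix-right d)
    mix-right (mod {Gs} {Ss} {Ps} {Ds} sh d) with A ∈? □* Gs ++ □* Ss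
    ... | yes A∈□GS = □-reduction red {Gs} {Ss} {Ps} {Ds} A∈□GS sh d (mix-right d)
    ... | no A∉□GS = ⊢-mono (∈-++⁺ʳ Γ ∘ ∉⇒⊆∖ A∉□GS) (∈-++⁺ʳ (Δ ∖ A)) (mod {Gs} {Ss} {Ps} {Ds} sh d)

  ⊤-reductions : ∀ {Γ Δ} → Reductions ⊤' Γ Δ
  ⊤-reductions = record
    { ¬-reduction = λ () ; ∧-reduction = λ () ; ∨-reduction = λ () ; ⇒-reduction = λ ()
    ; □-reduction = λ {Gs} m → ⊥-elim (∉-□*-++ Gs top m) }

  ¬-reductions : ∀ {c Γ Δ} → Mixable c → MixableWith (¬' c) (c ∷ Γ) Δ → Reductions (¬' c) Γ (¬' c ∷ Δ)
  ¬-reductions {c} {Γ} {Δ} mix-c mix-premise = record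
    { ¬-reduction = reduce ; ∧-reduction = λ () ; ∨-reduction = λ () ; ⇒-reduction = λ ()
    ; □-reduction = λ {Gs} m → ⊥-elim (∉-□*-++ Gs neg m) }
    where
    A : Fm
    A = ¬' c
    reduce : ∀ {c′ Θ Λ} → A ≡ ¬' c′ → ⊢ Θ ⟹ c′ ∷ Λ →
      ⊢ Γ ++ Θ ∖ A ⟹ (A ∷ Δ) ∖ A ++ c′ ∷ Λ → ⊢ Γ ++ (¬' c′ ∷ Θ) ∖ A ⟹ (A ∷ Δ) ∖ A ++ Λ
    reduce {Θ = Θ} refl d mix-d =
      cut-by-mix mix-c
        (⊢-mono (weaken-∖ˡ {A} {A} Γ {Θ}) (++-∷-⊆ ((A ∷ Δ) ∖ A)) mix-d)
        (⊢-mono ⊆-refl (weaken-∖ʳ {A} {A} Δ) (mix-premise (¬L d)))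

  ∧-reductions : ∀ {a b Γ Δ} → Mixable a → Mixable b →
    MixableWith (a ∧' b) Γ (a ∷ Δ) → MixableWith (a ∧' b) Γ (b ∷ Δ) →
    Reductions (a ∧' b) Γ (a ∧' b ∷ Δ)
  ∧-reductions {a} {b} {Γ} {Δ} mix-a mix-b mix-premise₁ mix-premise₂ = record
    { ¬-reduction = λ () ; ∧-reduction = reduce ; ∨-reduction = λ () ; ⇒-reduction = λ ()
    ; □-reduction = λ {Gs} m → ⊥-elim (∉-□*-++ Gs and m) }
    where
    A : Fm
    A = a ∧' b
    reduce : ∀ {a′ b′ Θ Λ} → A ≡ a′ ∧' b′ → ⊢ a′ ∷ b′ ∷ Θ ⟹ Λ →
      ⊢ Γ ++ (a′ ∷ b′ ∷ Θ) ∖ A ⟹ (A ∷ Δ) ∖ A ++ Λ →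
      ⊢ Γ ++ (a′ ∧' b′ ∷ Θ) ∖ A ⟹ (A ∷ Δ) ∖ A ++ Λ
    reduce {Θ = Θ} refl d mix-d =
      cut-by-mix mix-b (⊢-mono ⊆-refl (pull-∖ʳ-∷ {A} {b} {A} Δ) (mix-premise₂ (∧L d)))
        (cut-by-mix mix-a (⊢-mono there (pull-∖ʳ-∷ {A} {a} {A} Δ) (mix-premise₁ (∧L d)))
          (⊢-mono (∷⁺ʳ a (pull-∖ˡ-∷ {A} {b} {A} Γ {Θ}) ∘ pull-∖ˡ {A} {a} Γ {b ∷ Θ}) ⊆-refl mix-d))

  ∨-reductions : ∀ {a b Γ Δ} → Mixable a → Mixable b →
    MixableWith (a ∨' b) Γ (a ∷ b ∷ Δ) → Reductions (a ∨' b) Γ (a ∨' b ∷ Δ)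
  ∨-reductions {a} {b} {Γ} {Δ} mix-a mix-b mix-premise = record
    { ¬-reduction = λ () ; ∧-reduction = λ () ; ∨-reduction = reduce ; ⇒-reduction = λ ()
    ; □-reduction = λ {Gs} m → ⊥-elim (∉-□*-++ Gs or m) }
    where
    A : Fm
    A = a ∨' b
    reduce : ∀ {a′ b′ Θ Λ} → A ≡ a′ ∨' b′ → ⊢ a′ ∷ Θ ⟹ Λ → ⊢ b′ ∷ Θ ⟹ Λ →
      ⊢ Γ ++ (a′ ∷ Θ) ∖ A ⟹ (A ∷ Δ) ∖ A ++ Λ → ⊢ Γ ++ (b′ ∷ Θ) ∖ A ⟹ (A ∷ Δ) ∖ A ++ Λ →
      ⊢ Γ ++ (a′ ∨' b′ ∷ Θ) ∖ A ⟹ (A ∷ Δ) ∖ A ++ Λ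
    reduce {Θ = Θ} refl d e mix-d mix-e =
      cut-by-mix mix-b
        (cut-by-mix mix-a
          (⊢-mono ⊆-refl (∷⁺ʳ a (pull-∖ʳ-∷ {A} {b} {A} Δ) ∘ pull-∖ʳ {A} {a} (b ∷ Δ)) (mix-premise (∨L d e)))
          (⊢-mono (pull-∖ˡ-∷ {A} {a} {A} Γ {Θ}) there mix-d))
        (⊢-mono (pull-∖ˡ-∷ {A} {b} {A} Γ {Θ}) ⊆-refl mix-e)

  ⇒-reductions : ∀ {a b Γ Δ} → Mixable a → Mixable b →
    MixableWith (a ⇒' b) (a ∷ Γ) (b ∷ Δ) → Reductions (a ⇒' b) Γ (a ⇒' b ∷ Δ)
  ⇒-reductions {a} {b} {Γ} {Δ} mix-a mix-b mix-premise = record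
    { ¬-reduction = λ () ; ∧-reduction = λ () ; ∨-reduction = λ () ; ⇒-reduction = reduce
    ; □-reduction = λ {Gs} m → ⊥-elim (∉-□*-++ Gs imp m) }
    where
    A : Fm
    A = a ⇒' b
    reduce : ∀ {a′ b′ Θ Λ} → A ≡ a′ ⇒' b′ → ⊢ Θ ⟹ a′ ∷ Λ → ⊢ b′ ∷ Θ ⟹ Λ →
      ⊢ Γ ++ Θ ∖ A ⟹ (A ∷ Δ) ∖ A ++ a′ ∷ Λ → ⊢ Γ ++ (b′ ∷ Θ) ∖ A ⟹ (A ∷ Δ) ∖ A ++ Λ →
      ⊢ Γ ++ (a′ ⇒' b′ ∷ Θ) ∖ A ⟹ (A ∷ Δ) ∖ A ++ Λ
    reduce {Θ = Θ} refl d e mix-d mix-e =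
      cut-by-mix mix-a
        (⊢-mono (weaken-∖ˡ {A} {A} Γ {Θ}) (++-∷-⊆ ((A ∷ Δ) ∖ A)) mix-d)
        (cut-by-mix mix-b
          (⊢-mono ⊆-refl (pull-∖ʳ-∷ {A} {b} {A} Δ) (mix-premise (⇒L d e)))
          (⊢-mono (∷⁺ʳ b there ∘ pull-∖ˡ-∷ {A} {b} {A} Γ {Θ}) ⊆-refl mix-e))

  -- Mixing on □B the conclusions of two modal rules, with B in Π₁ or Δ₁ of the left
  -- instance and in Γ₂ or Σ₂ of the right one, can be reduced in six ways; each needs
  -- the composite rule below (the r's are the lengths of the lists after deleting B).
  record ShapeClosure : Set where
    field
      right-into-left : ∀ {g1 s1 p1 d1 g2 s2 p2 d2 rg rs rd} →
        Shape R g1 s1 p1 d1 → Shape R g2 s2 p2 d2 →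
        rd < d1 → rg ≤ g2 → rs ≤ s2 → rg + rs < g2 + s2 →
        Admissible R (g1 + (rg + rs)) s1 p1 (rd + (p2 + d2))
      left-into-right : ∀ {g1 s1 p1 d1 g2 s2 p2 d2 rp rd rg} →
        Shape R g1 s1 p1 d1 → Shape R g2 s2 p2 d2 →
        rp < p1 → rd ≤ d1 → rg < g2 →
        Admissible R (g1 + (s1 + rg)) s2 p2 (rp + (rd + d2))
      principal : ∀ {g1 s1 p1 d1 g2 s2 p2 d2 rs} →
        Shape R g1 s1 p1 d1 → Shape R g2 s2 p2 d2 →
        1 ≤ p1 → rs < s2 →
        Admissible R (g1 + g2) (s1 + rs) p2 (d1 + d2)
      principal-right-into-left : ∀ {g1 s1 p1 d1 g2 s2 p2 d2 rs rd} →
        Shape R g1 s1 p1 d1 → Shape R g2 s2 p2 d2 →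
        1 ≤ p1 → rs < s2 → rd < d1 →
        Admissible R (g1 + (g2 + rs)) (s1 + rs) p2 (rd + (p2 + d2))
      principal-left-into-right : ∀ {g1 s1 p1 d1 g2 s2 p2 d2 rp rs rg} →
        Shape R g1 s1 p1 d1 → Shape R g2 s2 p2 d2 →
        rp < p1 → rs < s2 → rg < g2 →
        Admissible R (g1 + (s1 + rg)) (s1 + rs) p2 (rp + (d1 + d2))
      principal-both : ∀ {g1 s1 p1 d1 g2 s2 p2 d2 rp rs rg rd} →
        Shape R g1 s1 p1 d1 → Shape R g2 s2 p2 d2 →
        rp < p1 → rs < s2 → rg < g2 → rd < d1 →
        Admissible R (g1 + (s1 + (rg + rs))) (s1 + rs) p2 (rp + (rd + (p2 + d2)))

  length-++₃ : ∀ (xs ys zs : List Fm) → length (xs ++ ys ++ zs) ≡ length xs + (length ys + length zs)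
  length-++₃ xs ys zs = trans (length-++ xs) (cong (length xs +_) (length-++ ys))

  length-++₄ : ∀ (ws xs ys zs : List Fm) →
    length (ws ++ xs ++ ys ++ zs) ≡ length ws + (length xs + (length ys + length zs))
  length-++₄ ws xs ys zs = trans (length-++ ws) (cong (length ws +_) (length-++₃ xs ys zs))

  module ModalReduction (closure : ShapeClosure) (B : Fm)
    {G1 S1 P1 D1 : List Fm}
    (sh1 : Shape R (length G1) (length S1) (length P1) (length D1))
    (π1 : ⊢ □* G1 ++ S1 ⟹ P1 ++ □* D1)
    (B∈P1D1 : B ∈ P1 ++ D1)
    (mix-B : Mixable B)
    (mix-left-premise : MixableWith (□ B) (□* G1 ++ S1) (P1 ++ □* D1))
    {G2 S2 P2 D2 : List Fm}
    (□B∈G2S2 : □ B ∈ □* G2 ++ □* S2)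
    (sh2 : Shape R (length G2) (length S2) (length P2) (length D2))
    (π2 : ⊢ □* G2 ++ S2 ⟹ P2 ++ □* D2)
    (mix-into-right-premise :
      ⊢ (□* G1 ++ □* S1) ++ (□* G2 ++ S2) ∖ □ B ⟹ (□* P1 ++ □* D1) ∖ □ B ++ P2 ++ □* D2)
    where
    open ShapeClosure closure

    A : Fm
    A = □ B

    Γ* Δ* : List Fm
    Γ* = (□* G1 ++ □* S1) ++ (□* G2 ++ □* S2) ∖ A
    Δ* = (□* P1 ++ □* D1) ∖ A ++ □* P2 ++ □* D2

    G* D* : List Fm
    G* = G1 ++ S1 ++ G2 ∖ B ++ S2 ∖ B
    D* = P1 ∖ B ++ D1 ∖ B ++ P2 ++ D2

    B∈G2S2 : B ∈ G2 ++ S2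
    B∈G2S2 = ∈-□*-++⁻ G2 □B∈G2S2

    G1⊆G* : G1 ⊆ G*
    G1⊆G* = ∈-++⁺ˡ
    S1⊆G* : S1 ⊆ G*
    S1⊆G* = ∈-++⁺ʳ G1 ∘ ∈-++⁺ˡ
    G2∖B⊆G* : G2 ∖ B ⊆ G*
    G2∖B⊆G* = ∈-++⁺ʳ G1 ∘ ∈-++⁺ʳ S1 ∘ ∈-++⁺ˡ
    S2∖B⊆G* : S2 ∖ B ⊆ G*
    S2∖B⊆G* = ∈-++⁺ʳ G1 ∘ ∈-++⁺ʳ S1 ∘ ∈-++⁺ʳ (G2 ∖ B)
    P1∖B⊆D* : P1 ∖ B ⊆ D*
    P1∖B⊆D* = ∈-++⁺ˡ
    D1∖B⊆D* : D1 ∖ B ⊆ D*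
    D1∖B⊆D* = ∈-++⁺ʳ (P1 ∖ B) ∘ ∈-++⁺ˡ
    P2⊆D* : P2 ⊆ D*
    P2⊆D* = ∈-++⁺ʳ (P1 ∖ B) ∘ ∈-++⁺ʳ (D1 ∖ B) ∘ ∈-++⁺ˡ
    D2⊆D* : D2 ⊆ D*
    D2⊆D* = ∈-++⁺ʳ (P1 ∖ B) ∘ ∈-++⁺ʳ (D1 ∖ B) ∘ ∈-++⁺ʳ P2

    □G*⊆Γ* : □* G* ⊆ Γ*
    □G*⊆Γ* =
      ++-lub (∈-++⁺ˡ ∘ ∈-++⁺ˡ)
        (++-lub (∈-++⁺ˡ ∘ ∈-++⁺ʳ (□* G1))
                (∈-++⁺ʳ (□* G1 ++ □* S1) ∘ ∖-mono {A} (□*-++ G2 {S2}) ∘ ∖□⁻ {B} (G2 ++ S2) ∘ map⁺ □_ ∖-++-⊇)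
         ∘ □*-++ S1)
      ∘ □*-++ G1
      where
      ∖-++-⊇ : G2 ∖ B ++ S2 ∖ B ⊆ (G2 ++ S2) ∖ B
      ∖-++-⊇ = ⊆-reflexive (sym (∖-++ G2))

    □D*⊆Δ* : □* D* ⊆ Δ*
    □D*⊆Δ* =
      ++-lub (∈-++⁺ˡ ∘ ∖-mono {A} {□* P1} ∈-++⁺ˡ ∘ ∖□⁻ {B} P1)
        (++-lub (∈-++⁺ˡ ∘ ∖-mono {A} {□* D1} (∈-++⁺ʳ (□* P1)) ∘ ∖□⁻ {B} D1)
                (∈-++⁺ʳ ((□* P1 ++ □* D1) ∖ A) ∘ □*-++ P2)
         ∘ □*-++ (D1 ∖ B))
      ∘ □*-++ (P1 ∖ B)

    conclude : ∀ {g s p d Gs Ss Ps Ds} → Admissible R g s p d →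
      length Gs ≡ g → length Ss ≡ s → length Ps ≡ p → length Ds ≡ d →
      ⊢ □* Gs ++ Ss ⟹ Ps ++ □* Ds → Gs ⊆ G* → Ss ⊆ G* → Ps ⊆ D* → Ds ⊆ D* → ⊢ Γ* ⟹ Δ*
    conclude {Gs = Gs} {Ss} {Ps} {Ds} ok eG eS eP eD π Gs⊆ Ss⊆ Ps⊆ Ds⊆ =
      ⊢-mono (++-lub (□G*⊆Γ* ∘ map⁺ □_ Gs⊆) (□G*⊆Γ* ∘ map⁺ □_ Ss⊆))
             (++-lub (□D*⊆Δ* ∘ map⁺ □_ Ps⊆) (□D*⊆Δ* ∘ map⁺ □_ Ds⊆))
             (mod-admissible {Γ = Gs} {Ss} {Ps} {Ds} ok eG eS eP eD π)

    mix-into-left-premise : ⊢ (□* G1 ++ S1) ++ (□* G2 ++ □* S2) ∖ A ⟹ (P1 ++ □* D1) ∖ A ++ □* P2 ++ □* D2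
    mix-into-left-premise = mix-left-premise (mod {G2} {S2} {P2} {D2} sh2 π2)

    by-right-into-left : B ∉ P1 → B ∈ D1 → ⊢ Γ* ⟹ Δ*
    by-right-into-left B∉P1 B∈D1 =
      conclude (right-into-left sh1 sh2
                  (length-∖-< {B} D1 B∈D1) (length-∖ {B} G2) (length-∖ {B} S2) (length-∖-++-< G2 B∈G2S2))
        (length-++₃ G1 (G2 ∖ B) (S2 ∖ B)) refl refl (length-++₃ (D1 ∖ B) P2 D2)
        (⊢-mono antecedent⊆ succedent⊆ mix-into-left-premise)
        (++-lub G1⊆G* (++-lub G2∖B⊆G* S2∖B⊆G*)) S1⊆G* (P1∖B⊆D* ∘ ∉⇒⊆∖ B∉P1) (++-lub D1∖B⊆D* (++-lub P2⊆D* D2⊆D*))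
      where
      G′ : List Fm
      G′ = G1 ++ G2 ∖ B ++ S2 ∖ B
      D′ : List Fm
      D′ = D1 ∖ B ++ P2 ++ D2
      antecedent⊆ : (□* G1 ++ S1) ++ (□* G2 ++ □* S2) ∖ A ⊆ □* G′ ++ S1
      antecedent⊆ =
        ++-lub (++-lub (∈-++⁺ˡ {xs = □* G′} ∘ map⁺ □_ (∈-++⁺ˡ {xs = G1})) (∈-++⁺ʳ (□* G′)))
               (∈-++⁺ˡ {xs = □* G′} ∘ □*-++⁻ G1 ∘ ∈-++⁺ʳ (□* G1) ∘ □*-++⁻ (G2 ∖ B) {S2 ∖ B} ∘ ∖□-++□ G2 {S2})
      succedent⊆ : (P1 ++ □* D1) ∖ A ++ □* P2 ++ □* D2 ⊆ P1 ++ □* D′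
      succedent⊆ =
        ++-lub (++-lub (∈-++⁺ˡ {xs = P1}) (∈-++⁺ʳ P1 ∘ map⁺ □_ (∈-++⁺ˡ {xs = D1 ∖ B})) ∘ ∖-++□ P1 {D1})
               (∈-++⁺ʳ P1 ∘ map⁺ □_ (∈-++⁺ʳ (D1 ∖ B)) ∘ □*-++⁻ P2 {D2})

    by-left-into-right : B ∈ P1 → B ∉ S2 → B ∈ G2 → ⊢ Γ* ⟹ Δ*
    by-left-into-right B∈P1 B∉S2 B∈G2 =
      conclude (left-into-right sh1 sh2 (length-∖-< {B} P1 B∈P1) (length-∖ {B} D1) (length-∖-< {B} G2 B∈G2))
        (length-++₃ G1 S1 (G2 ∖ B)) refl refl (length-++₃ (P1 ∖ B) (D1 ∖ B) D2)
        (⊢-mono antecedent⊆ succedent⊆ mix-into-right-premise)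
        (++-lub G1⊆G* (++-lub S1⊆G* G2∖B⊆G*)) (S2∖B⊆G* ∘ ∉⇒⊆∖ B∉S2) P2⊆D* (++-lub P1∖B⊆D* (++-lub D1∖B⊆D* D2⊆D*))
      where
      G′ : List Fm
      G′ = G1 ++ S1 ++ G2 ∖ B
      D′ : List Fm
      D′ = P1 ∖ B ++ D1 ∖ B ++ D2
      antecedent⊆ : (□* G1 ++ □* S1) ++ (□* G2 ++ S2) ∖ A ⊆ □* G′ ++ S2
      antecedent⊆ =
        ++-lub (++-lub (∈-++⁺ˡ {xs = □* G′} ∘ map⁺ □_ (∈-++⁺ˡ {xs = G1}))
                       (∈-++⁺ˡ {xs = □* G′} ∘ map⁺ □_ (∈-++⁺ʳ G1 ∘ ∈-++⁺ˡ {xs = S1})))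
               (++-lub (∈-++⁺ˡ {xs = □* G′} ∘ map⁺ □_ (∈-++⁺ʳ G1 ∘ ∈-++⁺ʳ S1)) (∈-++⁺ʳ (□* G′)) ∘ ∖□-++ G2 {S2})
      succedent⊆ : (□* P1 ++ □* D1) ∖ A ++ P2 ++ □* D2 ⊆ P2 ++ □* D′
      succedent⊆ =
        ++-lub (++-lub (∈-++⁺ʳ P2 ∘ map⁺ □_ (∈-++⁺ˡ {xs = P1 ∖ B}))
                       (∈-++⁺ʳ P2 ∘ map⁺ □_ (∈-++⁺ʳ (P1 ∖ B) ∘ ∈-++⁺ˡ {xs = D1 ∖ B}))
                ∘ ∖□-++□ P1 {D1})
               (++-lub (∈-++⁺ˡ {xs = P2}) (∈-++⁺ʳ P2 ∘ map⁺ □_ (∈-++⁺ʳ (P1 ∖ B) ∘ ∈-++⁺ʳ (D1 ∖ B))))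

    by-principal : B ∈ P1 → B ∈ S2 → B ∉ G2 → B ∉ D1 → ⊢ Γ* ⟹ Δ*
    by-principal B∈P1 B∈S2 B∉G2 B∉D1 =
      conclude (principal sh1 sh2 (∈-length B∈P1) (length-∖-< {B} S2 B∈S2))
        (length-++ G1) (length-++ S1) refl (length-++ D1)
        (⊢-mono antecedent⊆ succedent⊆ (mix-B π1 π2))
        (++-lub G1⊆G* (G2∖B⊆G* ∘ ∉⇒⊆∖ B∉G2)) (++-lub S1⊆G* S2∖B⊆G*) P2⊆D* (++-lub (D1∖B⊆D* ∘ ∉⇒⊆∖ B∉D1) D2⊆D*)
      where
      G′ : List Fm
      G′ = G1 ++ G2
      S′ : List Fm
      S′ = S1 ++ S2 ∖ B
      D′ : List Fm
      D′ = D1 ++ D2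
      antecedent⊆ : (□* G1 ++ S1) ++ (□* G2 ++ S2) ∖ B ⊆ □* G′ ++ S′
      antecedent⊆ =
        ++-lub (++-lub (∈-++⁺ˡ {xs = □* G′} ∘ map⁺ □_ (∈-++⁺ˡ {xs = G1})) (∈-++⁺ʳ (□* G′) ∘ ∈-++⁺ˡ {xs = S1}))
               (++-lub (∈-++⁺ˡ {xs = □* G′} ∘ map⁺ □_ (∈-++⁺ʳ G1)) (∈-++⁺ʳ (□* G′) ∘ ∈-++⁺ʳ S1) ∘ ∖-++-⊆ʳ (□* G2) {S2})
      succedent⊆ : (P1 ++ □* D1) ∖ B ++ P2 ++ □* D2 ⊆ P2 ++ □* D′
      succedent⊆ =
        ++-lub (++-lub (∖-≤1-⊆ (Shape-p≤1 sh1) B∈P1) (∈-++⁺ʳ P2 ∘ map⁺ □_ (∈-++⁺ˡ {xs = D1})) ∘ ∖-++-⊆ˡ P1 {□* D1})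
               (++-lub (∈-++⁺ˡ {xs = P2}) (∈-++⁺ʳ P2 ∘ map⁺ □_ (∈-++⁺ʳ D1)))

    by-principal-right-into-left : B ∈ P1 → B ∈ S2 → B ∉ G2 → B ∈ D1 → ⊢ Γ* ⟹ Δ*
    by-principal-right-into-left B∈P1 B∈S2 B∉G2 B∈D1 =
      conclude (principal-right-into-left sh1 sh2
                  (∈-length B∈P1) (length-∖-< {B} S2 B∈S2) (length-∖-< {B} D1 B∈D1))
        (length-++₃ G1 G2 (S2 ∖ B)) (length-++ S1) refl (length-++₃ (D1 ∖ B) P2 D2)
        (⊢-mono antecedent⊆ succedent⊆ (mix-B mix-into-left-premise π2))
        (++-lub G1⊆G* (++-lub (G2∖B⊆G* ∘ ∉⇒⊆∖ B∉G2) S2∖B⊆G*)) (++-lub S1⊆G* S2∖B⊆G*)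
        P2⊆D* (++-lub D1∖B⊆D* (++-lub P2⊆D* D2⊆D*))
      where
      G′ : List Fm
      G′ = G1 ++ G2 ++ S2 ∖ B
      S′ : List Fm
      S′ = S1 ++ S2 ∖ B
      D′ : List Fm
      D′ = D1 ∖ B ++ P2 ++ D2
      antecedent⊆ : ((□* G1 ++ S1) ++ (□* G2 ++ □* S2) ∖ A) ++ (□* G2 ++ S2) ∖ B ⊆ □* G′ ++ S′
      antecedent⊆ =
        ++-lub (++-lub (++-lub (∈-++⁺ˡ {xs = □* G′} ∘ map⁺ □_ (∈-++⁺ˡ {xs = G1})) (∈-++⁺ʳ (□* G′) ∘ ∈-++⁺ˡ {xs = S1}))
                       (++-lub (∈-++⁺ˡ {xs = □* G′} ∘ map⁺ □_ (∈-++⁺ʳ G1 ∘ ∈-++⁺ˡ {xs = G2}) ∘ map⁺ □_ (∖-⊆ G2))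
                               (∈-++⁺ˡ {xs = □* G′} ∘ map⁺ □_ (∈-++⁺ʳ G1 ∘ ∈-++⁺ʳ G2))
                        ∘ ∖□-++□ G2 {S2}))
               (++-lub (∈-++⁺ˡ {xs = □* G′} ∘ map⁺ □_ (∈-++⁺ʳ G1 ∘ ∈-++⁺ˡ {xs = G2})) (∈-++⁺ʳ (□* G′) ∘ ∈-++⁺ʳ S1)
                ∘ ∖-++-⊆ʳ (□* G2) {S2})
      succedent⊆ : ((P1 ++ □* D1) ∖ A ++ □* P2 ++ □* D2) ∖ B ++ P2 ++ □* D2 ⊆ P2 ++ □* D′
      succedent⊆ =
        ++-lub (++-lub (++-lub (∖-≤1-⊆ (Shape-p≤1 sh1) B∈P1) (∈-++⁺ʳ P2 ∘ map⁺ □_ (∈-++⁺ˡ {xs = D1 ∖ B}))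
                        ∘ ∖-++-⊆ˡ P1 {□* (D1 ∖ B)} ∘ ∖-mono {B} (∖-++□ P1 {D1}))
                       (∈-++⁺ʳ P2 ∘ map⁺ □_ (∈-++⁺ʳ (D1 ∖ B)) ∘ □*-++⁻ P2 {D2})
                ∘ ∖-++-⊆ˡ ((P1 ++ □* D1) ∖ A) {□* P2 ++ □* D2})
               (++-lub (∈-++⁺ˡ {xs = P2}) (∈-++⁺ʳ P2 ∘ map⁺ □_ (∈-++⁺ʳ (D1 ∖ B) ∘ ∈-++⁺ʳ P2)))

    by-principal-left-into-right : B ∈ P1 → B ∈ S2 → B ∈ G2 → B ∉ D1 → ⊢ Γ* ⟹ Δ*
    by-principal-left-into-right B∈P1 B∈S2 B∈G2 B∉D1 =
      conclude (principal-left-into-right sh1 sh2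
                  (length-∖-< {B} P1 B∈P1) (length-∖-< {B} S2 B∈S2) (length-∖-< {B} G2 B∈G2))
        (length-++₃ G1 S1 (G2 ∖ B)) (length-++ S1) refl (length-++₃ (P1 ∖ B) D1 D2)
        (⊢-mono antecedent⊆ succedent⊆ (mix-B π1 mix-into-right-premise))
        (++-lub G1⊆G* (++-lub S1⊆G* G2∖B⊆G*)) (++-lub S1⊆G* S2∖B⊆G*)
        P2⊆D* (++-lub P1∖B⊆D* (++-lub (D1∖B⊆D* ∘ ∉⇒⊆∖ B∉D1) D2⊆D*))
      where
      G′ : List Fm
      G′ = G1 ++ S1 ++ G2 ∖ B
      S′ : List Fm
      S′ = S1 ++ S2 ∖ B
      D′ : List Fm
      D′ = P1 ∖ B ++ D1 ++ D2
      antecedent⊆ : (□* G1 ++ S1) ++ ((□* G1 ++ □* S1) ++ (□* G2 ++ S2) ∖ A) ∖ B ⊆ □* G′ ++ S′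
      antecedent⊆ =
        ++-lub (++-lub (∈-++⁺ˡ {xs = □* G′} ∘ map⁺ □_ (∈-++⁺ˡ {xs = G1})) (∈-++⁺ʳ (□* G′) ∘ ∈-++⁺ˡ {xs = S1}))
               (++-lub (++-lub (∈-++⁺ˡ {xs = □* G′} ∘ map⁺ □_ (∈-++⁺ˡ {xs = G1}))
                               (∈-++⁺ˡ {xs = □* G′} ∘ map⁺ □_ (∈-++⁺ʳ G1 ∘ ∈-++⁺ˡ {xs = S1})))
                       (++-lub (∈-++⁺ˡ {xs = □* G′} ∘ map⁺ □_ (∈-++⁺ʳ G1 ∘ ∈-++⁺ʳ S1)) (∈-++⁺ʳ (□* G′) ∘ ∈-++⁺ʳ S1)
                        ∘ ∖-++-⊆ʳ (□* (G2 ∖ B)) {S2} ∘ ∖-mono {B} (∖□-++ G2 {S2}))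
                ∘ ∖-++-⊆ʳ (□* G1 ++ □* S1))
      succedent⊆ : (P1 ++ □* D1) ∖ B ++ (□* P1 ++ □* D1) ∖ A ++ P2 ++ □* D2 ⊆ P2 ++ □* D′
      succedent⊆ =
        ++-lub (++-lub (∖-≤1-⊆ (Shape-p≤1 sh1) B∈P1) (∈-++⁺ʳ P2 ∘ map⁺ □_ (∈-++⁺ʳ (P1 ∖ B) ∘ ∈-++⁺ˡ {xs = D1}))
                ∘ ∖-++-⊆ˡ P1 {□* D1})
               (++-lub (++-lub (∈-++⁺ʳ P2 ∘ map⁺ □_ (∈-++⁺ˡ {xs = P1 ∖ B}))
                               (∈-++⁺ʳ P2 ∘ map⁺ □_ (∈-++⁺ʳ (P1 ∖ B) ∘ ∈-++⁺ˡ {xs = D1}) ∘ map⁺ □_ (∖-⊆ D1))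
                        ∘ ∖□-++□ P1 {D1})
                       (++-lub (∈-++⁺ˡ {xs = P2}) (∈-++⁺ʳ P2 ∘ map⁺ □_ (∈-++⁺ʳ (P1 ∖ B) ∘ ∈-++⁺ʳ D1))))

    by-principal-both : B ∈ P1 → B ∈ S2 → B ∈ G2 → B ∈ D1 → ⊢ Γ* ⟹ Δ*
    by-principal-both B∈P1 B∈S2 B∈G2 B∈D1 =
      conclude (principal-both sh1 sh2
                  (length-∖-< {B} P1 B∈P1) (length-∖-< {B} S2 B∈S2) (length-∖-< {B} G2 B∈G2) (length-∖-< {B} D1 B∈D1))
        (length-++₄ G1 S1 (G2 ∖ B) (S2 ∖ B)) (length-++ S1) refl (length-++₄ (P1 ∖ B) (D1 ∖ B) P2 D2)
        (⊢-mono antecedent⊆ succedent⊆ (mix-B mix-into-left-premise mix-into-right-premise))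
        ⊆-refl (++-lub S1⊆G* S2∖B⊆G*) P2⊆D* ⊆-refl
      where
      S′ : List Fm
      S′ = S1 ++ S2 ∖ B
      antecedent⊆ : ((□* G1 ++ S1) ++ (□* G2 ++ □* S2) ∖ A) ++ ((□* G1 ++ □* S1) ++ (□* G2 ++ S2) ∖ A) ∖ B
                    ⊆ □* G* ++ S′
      antecedent⊆ =
        ++-lub (++-lub (++-lub (∈-++⁺ˡ {xs = □* G*} ∘ map⁺ □_ G1⊆G*) (∈-++⁺ʳ (□* G*) ∘ ∈-++⁺ˡ {xs = S1}))
                       (++-lub (∈-++⁺ˡ {xs = □* G*} ∘ map⁺ □_ G2∖B⊆G*) (∈-++⁺ˡ {xs = □* G*} ∘ map⁺ □_ S2∖B⊆G*)
                        ∘ ∖□-++□ G2 {S2}))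
               (++-lub (++-lub (∈-++⁺ˡ {xs = □* G*} ∘ map⁺ □_ G1⊆G*) (∈-++⁺ˡ {xs = □* G*} ∘ map⁺ □_ S1⊆G*))
                       (++-lub (∈-++⁺ˡ {xs = □* G*} ∘ map⁺ □_ G2∖B⊆G*) (∈-++⁺ʳ (□* G*) ∘ ∈-++⁺ʳ S1)
                        ∘ ∖-++-⊆ʳ (□* (G2 ∖ B)) {S2} ∘ ∖-mono {B} (∖□-++ G2 {S2}))
                ∘ ∖-++-⊆ʳ (□* G1 ++ □* S1))
      succedent⊆ : ((P1 ++ □* D1) ∖ A ++ □* P2 ++ □* D2) ∖ B ++ (□* P1 ++ □* D1) ∖ A ++ P2 ++ □* D2
                   ⊆ P2 ++ □* D*
      succedent⊆ =
        ++-lub (++-lub (++-lub (∖-≤1-⊆ (Shape-p≤1 sh1) B∈P1) (∈-++⁺ʳ P2 ∘ map⁺ □_ D1∖B⊆D*)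
                        ∘ ∖-++-⊆ˡ P1 {□* (D1 ∖ B)} ∘ ∖-mono {B} (∖-++□ P1 {D1}))
                       (++-lub (∈-++⁺ʳ P2 ∘ map⁺ □_ P2⊆D*) (∈-++⁺ʳ P2 ∘ map⁺ □_ D2⊆D*))
                ∘ ∖-++-⊆ˡ ((P1 ++ □* D1) ∖ A) {□* P2 ++ □* D2})
               (++-lub (++-lub (∈-++⁺ʳ P2 ∘ map⁺ □_ P1∖B⊆D*) (∈-++⁺ʳ P2 ∘ map⁺ □_ D1∖B⊆D*) ∘ ∖□-++□ P1 {D1})
                       (++-lub (∈-++⁺ˡ {xs = P2}) (∈-++⁺ʳ P2 ∘ map⁺ □_ D2⊆D*)))

    reduce : ⊢ Γ* ⟹ Δ*
    reduce with B ∈? P1 | B ∈? S2 | B ∈? G2 | B ∈? D1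
    ... | no B∉P1  | _        | _        | _        = by-right-into-left B∉P1 (∈-++-∉ˡ P1 B∈P1D1 B∉P1)
    ... | yes B∈P1 | no B∉S2  | _        | _        = by-left-into-right B∈P1 B∉S2 (∈-++-∉ʳ G2 B∈G2S2 B∉S2)
    ... | yes B∈P1 | yes B∈S2 | no B∉G2  | no B∉D1  = by-principal B∈P1 B∈S2 B∉G2 B∉D1
    ... | yes B∈P1 | yes B∈S2 | no B∉G2  | yes B∈D1 = by-principal-right-into-left B∈P1 B∈S2 B∉G2 B∈D1
    ... | yes B∈P1 | yes B∈S2 | yes B∈G2 | no B∉D1  = by-principal-left-into-right B∈P1 B∈S2 B∈G2 B∉D1
    ... | yes B∈P1 | yes B∈S2 | yes B∈G2 | yes B∈D1 = by-principal-both B∈P1 B∈S2 B∈G2 B∈D1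

  MixableSubformulas : Fm → Set
  MixableSubformulas (¬' a)   = Mixable a
  MixableSubformulas (a ∧' b) = Mixable a × Mixable b
  MixableSubformulas (a ∨' b) = Mixable a × Mixable b
  MixableSubformulas (a ⇒' b) = Mixable a × Mixable b
  MixableSubformulas (□ b)    = Mixable b
  MixableSubformulas _        = ⊤

  -- Induction on the left derivation; where A is principal in its last rule, mix-right
  -- takes over.
  module MixLeft (closure : ShapeClosure) {A : Fm} (mix-sub : MixableSubformulas A) where
    open MixRight

    mix-left : Mixable A
    mix-left (exch {Γ₀} {Γ} {Δ₀} {Δ} p q d) right =
      ⊢-mono (++-lub {xs = Γ₀} (∈-++⁺ˡ ∘ ∈-resp-↭ p) (∈-++⁺ʳ Γ))
             (++-lub {xs = Δ₀ ∖ A} (∈-++⁺ˡ ∘ ∖-mono (∈-resp-↭ q)) (∈-++⁺ʳ (Δ ∖ A)))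
             (mix-left d right)
    mix-left (ax {Γ₀} {Δ₀} p) {Θ} right = case A ≟ var p of λ where
      (yes refl) → ⊢-mono (∷⁺ʳ (var p) (∈-++⁺ʳ Γ₀) ∘ ⊆∷∖ {var p} {Θ}) (∈-++⁺ʳ ((var p ∷ Δ₀) ∖ var p)) right
      (no A≢p) → ⊢-mono (∈-∷⁺ʳ (here refl) (λ ())) (∈-∷⁺ʳ (∈-++⁺ˡ (∈-∷∖ (A≢p ∘ sym))) (λ ()))
                   (ax {Γ = []} {Δ = []} p)
    mix-left ⊥L _ = ⊢-mono (∈-∷⁺ʳ (here refl) (λ ())) (λ ()) (⊥L {Γ = []} {Δ = []})
    mix-left left@⊤R right = case A ≟ ⊤' of λ where
      (yes refl) → mix-right (λ ()) left ⊤-reductions right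
      (no A≢⊤) → ⊢-mono (λ ()) (∈-∷⁺ʳ (∈-++⁺ˡ (∈-∷∖ (A≢⊤ ∘ sym))) (λ ())) (⊤R {Γ = []} {Δ = []})
    mix-left (¬L {Δ = Δ} d) right = ¬L (⊢-mono ⊆-refl (pull-∖ʳ Δ) (mix-left d right))
    mix-left (¬R {Δ = Δ} {c} d) right = case A ≟ ¬' c of λ where
      (yes refl) → mix-right (λ ()) (¬R d) (¬-reductions mix-sub (mix-left d)) right
      (no A≢¬c) → ⊢-mono ⊆-refl (push-∖ʳ Δ (A≢¬c ∘ sym)) (¬R (mix-left d right))
    mix-left (∧L d) right = ∧L (mix-left d right)
    mix-left (∧R {Δ = Δ} {a} {b} d e) right = case A ≟ a ∧' b of λ where
      (yes refl) → mix-right (λ ()) (∧R d e)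
                     (∧-reductions (proj₁ mix-sub) (proj₂ mix-sub) (mix-left d) (mix-left e)) right
      (no A≢a∧b) → ⊢-mono ⊆-refl (push-∖ʳ Δ (A≢a∧b ∘ sym))
                     (∧R (⊢-mono ⊆-refl (pull-∖ʳ Δ) (mix-left d right))
                         (⊢-mono ⊆-refl (pull-∖ʳ Δ) (mix-left e right)))
    mix-left (∨L d e) right = ∨L (mix-left d right) (mix-left e right)
    mix-left (∨R {Δ = Δ} {a} {b} d) right = case A ≟ a ∨' b of λ where
      (yes refl) → mix-right (λ ()) (∨R d) (∨-reductions (proj₁ mix-sub) (proj₂ mix-sub) (mix-left d)) right
      (no A≢a∨b) → ⊢-mono ⊆-refl (push-∖ʳ Δ (A≢a∨b ∘ sym))
                     (∨R (⊢-mono ⊆-refl (∷⁺ʳ a (pull-∖ʳ {A} {b} Δ) ∘ pull-∖ʳ {A} {a} (b ∷ Δ)) (mix-left d right)))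
    mix-left (⇒L {Δ = Δ} d e) right = ⇒L (⊢-mono ⊆-refl (pull-∖ʳ Δ) (mix-left d right)) (mix-left e right)
    mix-left (⇒R {Δ = Δ} {a} {b} d) right = case A ≟ a ⇒' b of λ where
      (yes refl) → mix-right (λ ()) (⇒R d) (⇒-reductions (proj₁ mix-sub) (proj₂ mix-sub) (mix-left d)) right
      (no A≢a⇒b) → ⊢-mono ⊆-refl (push-∖ʳ Δ (A≢a⇒b ∘ sym))
                     (⇒R (⊢-mono ⊆-refl (pull-∖ʳ Δ) (mix-left d right)))
    mix-left (wL d) right = wL (mix-left d right)
    mix-left (wR {Δ = Δ} d) right = ⊢-mono ⊆-refl (weaken-∖ʳ Δ) (mix-left d right)
    mix-left (cL d) right = cL (mix-left d right)
    mix-left (cR {Δ = Δ} {x} d) right =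
      ⊢-mono ⊆-refl
        (++-lub (∈-++⁺ˡ ∘ ∖-mono {A} {x ∷ x ∷ Δ} {x ∷ Δ} (∈-∷⁺ʳ (here refl) ⊆-refl)) (∈-++⁺ʳ ((x ∷ Δ) ∖ A)))
        (mix-left d right)
    mix-left left@(mod {G1} {S1} {P1} {D1} sh1 π1) right with boxView A
    ... | nonModal A-nonModal =
      ⊢-mono ∈-++⁺ˡ (∈-++⁺ˡ ∘ ∉⇒⊆∖ (∉-□*-++ P1 A-nonModal)) left
    ... | boxed B with B ∈? P1 ++ D1
    ...   | no B∉P1D1 = ⊢-mono ∈-++⁺ˡ (∈-++⁺ˡ ∘ ∉⇒⊆∖ (B∉P1D1 ∘ ∈-□*-++⁻ P1)) left
    ...   | yes B∈P1D1 = mix-right (λ ()) left reductions right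
      where
      reductions : Reductions (□ B) (□* G1 ++ □* S1) (□* P1 ++ □* D1)
      reductions = record
        { ¬-reduction = λ () ; ∧-reduction = λ () ; ∨-reduction = λ () ; ⇒-reduction = λ ()
        ; □-reduction = λ {G2} {S2} {P2} {D2} →
            ModalReduction.reduce closure B {G1} {S1} {P1} {D1} sh1 π1 B∈P1D1 mix-sub (mix-left π1)
              {G2} {S2} {P2} {D2} }

  module Mix (closure : ShapeClosure) where

    mix : ∀ A → Mixable A
    mix-subformulas : ∀ A → MixableSubformulas A

    mix A = MixLeft.mix-left closure (mix-subformulas A)

    mix-subformulas (var _)  = tt
    mix-subformulas ⊥'       = tt
    mix-subformulas ⊤'       = tt
    mix-subformulas (¬' a)   = mix a
    mix-subformulas (a ∧' b) = mix a , mix b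
    mix-subformulas (a ∨' b) = mix a , mix b
    mix-subformulas (a ⇒' b) = mix a , mix b
    mix-subformulas (□ b)    = mix b

module _ (R : Rules) where
  open Calculus R

  toDer-mod : ∀ {g s p d Γ Σ Π Δ} → Shape R g s p d →
    length Γ ≡ g → length Σ ≡ s → length Π ≡ p → length Δ ≡ d →
    Der R false (□* Γ ++ Σ ⟹ Π ++ □* Δ) → Der R false (□* Γ ++ □* Σ ⟹ □* Π ++ □* Δ)
  toDer-mod {Γ = Γ} {Σ} {Π} {Δ} (M t) eΓ eΣ eΠ eΔ d
    with length≡0 {Γ} eΓ | length≡1 {Σ} eΣ | length≡1 {Π} eΠ | length≡0 {Δ} eΔ
  ... | refl | _ , refl | _ , refl | refl = M t d
  toDer-mod {Γ = Γ} {Σ} {Π} {Δ} (N t) eΓ eΣ eΠ eΔ d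
    with length≡0 {Γ} eΓ | length≡0 {Σ} eΣ | length≡1 {Π} eΠ | length≡0 {Δ} eΔ
  ... | refl | refl | _ , refl | refl = N t d
  toDer-mod {Γ = Γ} {Σ} {Π} {Δ} (P t) eΓ eΣ eΠ eΔ d
    with length≡0 {Γ} eΓ | length≡1 {Σ} eΣ | length≡0 {Π} eΠ | length≡0 {Δ} eΔ
  ... | refl | _ , refl | refl | refl = P t d
  toDer-mod {Γ = Γ} {Σ} {Π} {Δ} (D t) eΓ eΣ eΠ eΔ d
    with length≡0 {Γ} eΓ | length≡2 {Σ} eΣ | length≡0 {Π} eΠ | length≡0 {Δ} eΔ
  ... | refl | _ , _ , refl | refl | refl = D t d
  toDer-mod {Γ = Γ} {Σ} {Π} {Δ} (R4 t) eΓ eΣ eΠ eΔ d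
    with length≡1 {Γ} eΓ | length≡0 {Σ} eΣ | length≡1 {Π} eΠ | length≡0 {Δ} eΔ
  ... | _ , refl | refl | _ , refl | refl = R4 t d
  toDer-mod {Γ = Γ} {Σ} {Π} {Δ} (R5 t) eΓ eΣ eΠ eΔ d
    with length≡0 {Γ} eΓ | length≡0 {Σ} eΣ | length≡1 {Π} eΠ | length≡1 {Δ} eΔ
  ... | refl | refl | _ , refl | _ , refl = R5 t d
  toDer-mod {Γ = Γ} {Σ} {Π} {Δ} (RD4 t) eΓ eΣ eΠ eΔ d
    with length≡1 {Γ} eΓ | length≡1 {Σ} eΣ | length≡0 {Π} eΠ | length≡0 {Δ} eΔ
  ... | b , refl | a , refl | refl | refl =
    exch (swap (□ a) (□ b) ↭-refl) ↭-refl (RD4 t (exch (swap (□ b) a ↭-refl) ↭-refl d))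
  toDer-mod {Γ = Γ} {Σ} {Π} {Δ} (RD5 t) eΓ eΣ eΠ eΔ d
    with length≡0 {Γ} eΓ | length≡1 {Σ} eΣ | length≡0 {Π} eΠ | length≡1 {Δ} eΔ
  ... | refl | _ , refl | refl | _ , refl = RD5 t d
  toDer-mod {Γ = Γ} {Σ} {Π} {Δ} (C t) eΓ eΣ eΠ eΔ d
    with length≡0 {Γ} eΓ | length≡1 {Π} eΠ | length≡0 {Δ} eΔ
  ... | refl | _ , refl | refl = C t (subst (1 ≤_) (sym eΣ) (s≤s z≤n)) d
  toDer-mod {Γ = Γ} {Σ} {Π} {Δ} (CD t) eΓ _ eΠ eΔ d
    with length≡0 {Γ} eΓ | length≡0 {Π} eΠ | length≡0 {Δ} eΔ
  ... | refl | refl | refl = CD t d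
  toDer-mod {Γ = Γ} {Σ} {Π} {Δ} (C4 t 1≤g+s) refl refl eΠ eΔ d
    with length≡1 {Π} eΠ | length≡0 {Δ} eΔ
  ... | _ , refl | refl = C4 {Γ = Γ} {Σ = Σ} t 1≤g+s d
  toDer-mod {Γ = Γ} {Σ} {Π} {Δ} (CD4 t) refl refl eΠ eΔ d
    with length≡0 {Π} eΠ | length≡0 {Δ} eΔ
  ... | refl | refl = CD4 {Γ = Γ} {Σ = Σ} t d
  toDer-mod {Γ = Γ} {Σ} {Π} {Δ} (K4 t) refl refl eΠ eΔ d
    with length≡1 {Π} eΠ | length≡0 {Δ} eΔ
  ... | _ , refl | refl = K4 {Γ = Γ} {Σ = Σ} t d
  toDer-mod {Γ = Γ} {Σ} {Π} {Δ} (K45 t) refl refl eΠ refl d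
    with length≡1 {Π} eΠ
  ... | _ , refl = K45 {Γ = Γ} {Σ = Σ} {Δ = Δ} t d
  toDer-mod {Γ = Γ} {Σ} {Π} {Δ} (KD45 t) refl refl eΠ refl d
    with length≡0 {Π} eΠ
  ... | refl = KD45 {Γ = Γ} {Σ = Σ} {Δ = Δ} t d

  toDer : ∀ {S} → ⊢ S → Der R false S
  toDer (exch p q d) = exch p q (toDer d)
  toDer (ax p)       = ax p
  toDer ⊥L           = ⊥L
  toDer ⊤R           = ⊤R
  toDer (¬L d)       = ¬L (toDer d)
  toDer (¬R d)       = ¬R (toDer d)
  toDer (∧L d)       = ∧L (toDer d)
  toDer (∧R d e)     = ∧R (toDer d) (toDer e)
  toDer (∨L d e)     = ∨L (toDer d) (toDer e)
  toDer (∨R d)       = ∨R (toDer d)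
  toDer (⇒L d e)     = ⇒L (toDer d) (toDer e)
  toDer (⇒R d)       = ⇒R (toDer d)
  toDer (wL d)       = wL (toDer d)
  toDer (wR d)       = wR (toDer d)
  toDer (cL d)       = cL (toDer d)
  toDer (cR d)       = cR (toDer d)
  toDer (mod {Γ} {Σ} {Π} {Δ} sh d) = toDer-mod {Γ = Γ} {Σ} {Π} {Δ} sh refl refl refl refl (toDer d)

module _ (R : Rules) (closure : Calculus.ShapeClosure R) (no-T : ¬ T (rT R)) where
  open Calculus R
  open Mix closure

  fromDer : ∀ {S} → Der R true S → ⊢ S
  fromDer (exch p q d) = exch p q (fromDer d)
  fromDer (ax p)       = ax p
  fromDer ⊥L           = ⊥L
  fromDer ⊤R           = ⊤R
  fromDer (¬L d)       = ¬L (fromDer d)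
  fromDer (¬R d)       = ¬R (fromDer d)
  fromDer (∧L d)       = ∧L (fromDer d)
  fromDer (∧R d e)     = ∧R (fromDer d) (fromDer e)
  fromDer (∨L d e)     = ∨L (fromDer d) (fromDer e)
  fromDer (∨R d)       = ∨R (fromDer d)
  fromDer (⇒L d e)     = ⇒L (fromDer d) (fromDer e)
  fromDer (⇒R d)       = ⇒R (fromDer d)
  fromDer (wL d)       = wL (fromDer d)
  fromDer (wR d)       = wR (fromDer d)
  fromDer (cL d)       = cL (fromDer d)
  fromDer (cR d)       = cR (fromDer d)
  fromDer (mcut {Γ} {Δ} {Σ} {Π} {A} n m _ d e) =
    ⊢-mono (++⁺ʳ Γ (∖-replicate-++ {A} (suc m) Σ)) (++⁺ˡ Π (∖-++-replicate {A} Δ (suc n)))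
      (mix A (fromDer d) (fromDer e))
  fromDer (M {A} {B} t d)   = mod {[]} {A ∷ []} {B ∷ []} {[]} (M t) (fromDer d)
  fromDer (N {A} t d)       = mod {[]} {[]} {A ∷ []} {[]} (N t) (fromDer d)
  fromDer (P {A} t d)       = mod {[]} {A ∷ []} {[]} {[]} (P t) (fromDer d)
  fromDer (D {A} {B} t d)   = mod {[]} {A ∷ B ∷ []} {[]} {[]} (D t) (fromDer d)
  fromDer (Tr t _)          = ⊥-elim (no-T t)
  fromDer (R4 {A} {B} t d)  = mod {A ∷ []} {[]} {B ∷ []} {[]} (R4 t) (fromDer d)
  fromDer (R5 {A} {B} t d)  = mod {[]} {[]} {A ∷ []} {B ∷ []} (R5 t) (fromDer d)
  fromDer (RD4 {A} {B} t d) =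
    exch (swap (□ B) (□ A) ↭-refl) ↭-refl
      (mod {B ∷ []} {A ∷ []} {[]} {[]} (RD4 t) (exch (swap A (□ B) ↭-refl) ↭-refl (fromDer d)))
  fromDer (RD5 {A} {B} t d) = mod {[]} {A ∷ []} {[]} {B ∷ []} (RD5 t) (fromDer d)
  fromDer (C {[]} t () _)
  fromDer (C {x ∷ Γ} {A} t _ d)         = mod {[]} {x ∷ Γ} {A ∷ []} {[]} (C t) (fromDer d)
  fromDer (CD {Γ} t d)                  = mod {[]} {Γ} {[]} {[]} (CD t) (fromDer d)
  fromDer (C4 {Γ} {Σ} {B} t 1≤g+s d)    = mod {Γ} {Σ} {B ∷ []} {[]} (C4 t 1≤g+s) (fromDer d)
  fromDer (CD4 {Γ} {Σ} t d)             = mod {Γ} {Σ} {[]} {[]} (CD4 t) (fromDer d)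
  fromDer (K4 {Γ} {Σ} {A} t d)          = mod {Γ} {Σ} {A ∷ []} {[]} (K4 t) (fromDer d)
  fromDer (K45 {Γ} {Σ} {Δ} {A} t d)     = mod {Γ} {Σ} {A ∷ []} {Δ} (K45 t) (fromDer d)
  fromDer (KD45 {Γ} {Σ} {Δ} t d)        = mod {Γ} {Σ} {[]} {Δ} (KD45 t) (fromDer d)

T-∧-intro : ∀ {x y} → T x → T y → T (x ∧ y)
T-∧-intro t u = Equivalence.from T-∧ (t , u)

T-∧-elim : ∀ x {y} → T (x ∧ y) → T x × T y
T-∧-elim x = Equivalence.to (T-∧ {x})

-- The one logic without C that has D and 5 also has 4: composing the D5-rule with D
-- needs the D4-rule.
module WithoutC (hasN hasP hasD has4 has5 : Bool) (D∧5⇒4 : T hasD → T has5 → T has4) where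
  R : Rules
  R = calculus (axioms hasN false hasP hasD false has4 has5)

  data MShape : ℕ → ℕ → ℕ → ℕ → Set where
    M   : MShape 0 1 1 0
    N   : T hasN → MShape 0 0 1 0
    P   : T hasP → MShape 0 1 0 0
    D   : T hasD → MShape 0 2 0 0
    R4  : T has4 → MShape 1 0 1 0
    R5  : T has5 → MShape 0 0 1 1
    RD4 : T hasD → T has4 → MShape 1 1 0 0
    RD5 : T hasD → T has5 → MShape 0 1 0 1

  classify : ∀ {g s p d} → Shape R g s p d → MShape g s p d
  classify (M _) = M
  classify (N t) = N t
  classify (P t) = P t
  classify (D t) = D t
  classify (R4 t) = R4 t
  classify (R5 t) = R5 t
  classify (RD4 t) = uncurry RD4 (T-∧-elim hasD t)
  classify (RD5 t) = uncurry RD5 (T-∧-elim hasD t)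
  classify (C ())
  classify (CD ())
  classify (C4 () _)
  classify (CD4 ())
  classify (K4 ())
  classify (K45 ())
  classify (KD45 ())

  right-into-left : ∀ {g1 s1 p1 d1 g2 s2 p2 d2 rg rs rd} → MShape g1 s1 p1 d1 → MShape g2 s2 p2 d2 →
       rd < d1 → rg ≤ g2 → rs ≤ s2 → rg + rs < g2 + s2 → Admissible R (g1 + (rg + rs)) s1 p1 (rd + (p2 + d2))
  right-into-left M _ () _ _ _
  right-into-left (N _) _ () _ _ _
  right-into-left (P _) _ () _ _ _
  right-into-left (D _) _ () _ _ _
  right-into-left (R4 _) _ () _ _ _
  right-into-left (RD4 _ _) _ () _ _ _
  right-into-left (R5 t) M (s≤s z≤n) z≤n z≤n _ = rule (R5 t)
  right-into-left (R5 t) M (s≤s z≤n) z≤n (s≤s z≤n) (s≤s ())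
  right-into-left (R5 t) (N _) (s≤s z≤n) z≤n z≤n ()
  right-into-left (R5 t) (P _) (s≤s z≤n) z≤n z≤n _ = N-by-5 (R5 t)
  right-into-left (R5 t) (P _) (s≤s z≤n) z≤n (s≤s z≤n) (s≤s ())
  right-into-left (R5 t) (D _) (s≤s z≤n) z≤n z≤n _ = N-by-5 (R5 t)
  right-into-left (R5 t) (D td) (s≤s z≤n) z≤n (s≤s z≤n) _ = rule (R4 (D∧5⇒4 td t))
  right-into-left (R5 t) (D _) (s≤s z≤n) z≤n (s≤s (s≤s z≤n)) (s≤s (s≤s ()))
  right-into-left (R5 t) (R4 _) (s≤s z≤n) z≤n z≤n _ = rule (R5 t)
  right-into-left (R5 t) (R4 _) (s≤s z≤n) (s≤s z≤n) z≤n (s≤s ())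
  right-into-left (R5 t) (R5 _) (s≤s z≤n) z≤n z≤n ()
  right-into-left (R5 t) (RD4 _ _) (s≤s z≤n) z≤n z≤n _ = N-by-5 (R5 t)
  right-into-left (R5 t) (RD4 _ t4) (s≤s z≤n) (s≤s z≤n) z≤n _ = rule (R4 t4)
  right-into-left (R5 t) (RD4 _ t4) (s≤s z≤n) z≤n (s≤s z≤n) _ = rule (R4 t4)
  right-into-left (R5 t) (RD4 _ _) (s≤s z≤n) (s≤s z≤n) (s≤s z≤n) (s≤s (s≤s ()))
  right-into-left (R5 t) (RD5 _ _) (s≤s z≤n) z≤n z≤n _ = rule (R5 t)
  right-into-left (R5 t) (RD5 _ _) (s≤s z≤n) z≤n (s≤s z≤n) (s≤s ())
  right-into-left (RD5 td t) M (s≤s z≤n) z≤n z≤n _ = rule (RD5 (T-∧-intro td t))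
  right-into-left (RD5 td t) M (s≤s z≤n) z≤n (s≤s z≤n) (s≤s ())
  right-into-left (RD5 td t) (N _) (s≤s z≤n) z≤n z≤n ()
  right-into-left (RD5 td t) (P tp) (s≤s z≤n) z≤n z≤n _ = rule (P tp)
  right-into-left (RD5 td t) (P _) (s≤s z≤n) z≤n (s≤s z≤n) (s≤s ())
  right-into-left (RD5 td t) (D _) (s≤s z≤n) z≤n z≤n _ = P-by-D (D td)
  right-into-left (RD5 td t) (D _) (s≤s z≤n) z≤n (s≤s z≤n) _ = rule (RD4 (T-∧-intro td (D∧5⇒4 td t)))
  right-into-left (RD5 td t) (D _) (s≤s z≤n) z≤n (s≤s (s≤s z≤n)) (s≤s (s≤s ()))
  right-into-left (RD5 td t) (R4 _) (s≤s z≤n) z≤n z≤n _ = rule (RD5 (T-∧-intro td t))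
  right-into-left (RD5 td t) (R4 _) (s≤s z≤n) (s≤s z≤n) z≤n (s≤s ())
  right-into-left (RD5 td t) (R5 _) (s≤s z≤n) z≤n z≤n ()
  right-into-left (RD5 td t) (RD4 _ _) (s≤s z≤n) z≤n z≤n _ = P-by-D (D td)
  right-into-left (RD5 td t) (RD4 _ t4) (s≤s z≤n) (s≤s z≤n) z≤n _ = rule (RD4 (T-∧-intro td t4))
  right-into-left (RD5 td t) (RD4 _ t4) (s≤s z≤n) z≤n (s≤s z≤n) _ = rule (RD4 (T-∧-intro td t4))
  right-into-left (RD5 td t) (RD4 _ _) (s≤s z≤n) (s≤s z≤n) (s≤s z≤n) (s≤s (s≤s ()))
  right-into-left (RD5 td t) (RD5 _ _) (s≤s z≤n) z≤n z≤n _ = rule (RD5 (T-∧-intro td t))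
  right-into-left (RD5 td t) (RD5 _ _) (s≤s z≤n) z≤n (s≤s z≤n) (s≤s ())

  left-into-right : ∀ {g1 s1 p1 d1 g2 s2 p2 d2 rp rd rg} → MShape g1 s1 p1 d1 → MShape g2 s2 p2 d2 →
       rp < p1 → rd ≤ d1 → rg < g2 → Admissible R (g1 + (s1 + rg)) s2 p2 (rp + (rd + d2))
  left-into-right (P _) _ () _ _
  left-into-right (D _) _ () _ _
  left-into-right (RD4 _ _) _ () _ _
  left-into-right (RD5 _ _) _ () _ _
  left-into-right _ M _ _ ()
  left-into-right _ (N _) _ _ ()
  left-into-right _ (P _) _ _ ()
  left-into-right _ (D _) _ _ ()
  left-into-right _ (R5 _) _ _ ()
  left-into-right _ (RD5 _ _) _ _ ()
  left-into-right M (R4 t4) (s≤s z≤n) z≤n (s≤s z≤n) = rule (R4 t4)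
  left-into-right M (RD4 td t4) (s≤s z≤n) z≤n (s≤s z≤n) = rule (RD4 (T-∧-intro td t4))
  left-into-right (N tn) (R4 t4) (s≤s z≤n) z≤n (s≤s z≤n) = rule (N tn)
  left-into-right (N tn) (RD4 td t4) (s≤s z≤n) z≤n (s≤s z≤n) = P-by-D (D td)
  left-into-right (R4 _) (R4 t4) (s≤s z≤n) z≤n (s≤s z≤n) = rule (R4 t4)
  left-into-right (R4 _) (RD4 td t4) (s≤s z≤n) z≤n (s≤s z≤n) = rule (RD4 (T-∧-intro td t4))
  left-into-right (R5 t5) (R4 t4) (s≤s z≤n) z≤n (s≤s z≤n) = N-by-5 (R5 t5)
  left-into-right (R5 t5) (R4 t4) (s≤s z≤n) (s≤s z≤n) (s≤s z≤n) = rule (R5 t5)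
  left-into-right (R5 t5) (RD4 td t4) (s≤s z≤n) z≤n (s≤s z≤n) = P-by-D (D td)
  left-into-right (R5 t5) (RD4 td t4) (s≤s z≤n) (s≤s z≤n) (s≤s z≤n) = rule (RD5 (T-∧-intro td t5))

  principal : ∀ {g1 s1 p1 d1 g2 s2 p2 d2 rs} → MShape g1 s1 p1 d1 → MShape g2 s2 p2 d2 →
       1 ≤ p1 → rs < s2 → Admissible R (g1 + g2) (s1 + rs) p2 (d1 + d2)
  principal (P _) _ () _
  principal (D _) _ () _
  principal (RD4 _ _) _ () _
  principal (RD5 _ _) _ () _
  principal _ (N _) _ ()
  principal _ (R4 _) _ ()
  principal _ (R5 _) _ ()
  principal M M _ (s≤s z≤n) = rule (M tt)
  principal M (P tp) _ (s≤s z≤n) = rule (P tp)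
  principal M (D td) _ (s≤s z≤n) = P-by-D (D td)
  principal M (D td) _ (s≤s (s≤s z≤n)) = rule (D td)
  principal M (RD4 td t4) _ (s≤s z≤n) = rule (RD4 (T-∧-intro td t4))
  principal M (RD5 td t5) _ (s≤s z≤n) = rule (RD5 (T-∧-intro td t5))
  principal (N tn) M _ (s≤s z≤n) = rule (N tn)
  principal (N tn) (P _) _ (s≤s z≤n) = identity
  principal (N tn) (D _) _ (s≤s z≤n) = identity
  principal (N tn) (D td) _ (s≤s (s≤s z≤n)) = P-by-D (D td)
  principal (N tn) (RD4 _ _) _ (s≤s z≤n) = identity
  principal (N tn) (RD5 _ _) _ (s≤s z≤n) = identity
  principal (R4 t4) M _ (s≤s z≤n) = rule (R4 t4)
  principal (R4 t4) (P _) _ (s≤s z≤n) = identity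
  principal (R4 t4) (D _) _ (s≤s z≤n) = identity
  principal (R4 t4) (D td) _ (s≤s (s≤s z≤n)) = rule (RD4 (T-∧-intro td t4))
  principal (R4 t4) (RD4 _ _) _ (s≤s z≤n) = identity
  principal (R4 t4) (RD5 _ _) _ (s≤s z≤n) = identity
  principal (R5 t5) M _ (s≤s z≤n) = rule (R5 t5)
  principal (R5 t5) (P _) _ (s≤s z≤n) = identity
  principal (R5 t5) (D _) _ (s≤s z≤n) = identity
  principal (R5 t5) (D td) _ (s≤s (s≤s z≤n)) = rule (RD5 (T-∧-intro td t5))
  principal (R5 t5) (RD4 _ _) _ (s≤s z≤n) = identity
  principal (R5 t5) (RD5 _ _) _ (s≤s z≤n) = identity

  principal-right-into-left : ∀ {g1 s1 p1 d1 g2 s2 p2 d2 rs rd} → MShape g1 s1 p1 d1 → MShape g2 s2 p2 d2 →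
        1 ≤ p1 → rs < s2 → rd < d1 → Admissible R (g1 + (g2 + rs)) (s1 + rs) p2 (rd + (p2 + d2))
  principal-right-into-left (P _) _ () _ _
  principal-right-into-left (D _) _ () _ _
  principal-right-into-left (RD4 _ _) _ () _ _
  principal-right-into-left (RD5 _ _) _ () _ _
  principal-right-into-left M _ _ _ ()
  principal-right-into-left (N _) _ _ _ ()
  principal-right-into-left (R4 _) _ _ _ ()
  principal-right-into-left _ (N _) _ () _
  principal-right-into-left _ (R4 _) _ () _
  principal-right-into-left _ (R5 _) _ () _
  principal-right-into-left (R5 t5) M _ (s≤s z≤n) (s≤s z≤n) = rule (R5 t5)
  principal-right-into-left (R5 t5) (P _) _ (s≤s z≤n) (s≤s z≤n) = identity
  principal-right-into-left (R5 t5) (D _) _ (s≤s z≤n) (s≤s z≤n) = identity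
  principal-right-into-left (R5 t5) (D td) _ (s≤s (s≤s z≤n)) (s≤s z≤n) = rule (RD4 (T-∧-intro td (D∧5⇒4 td t5)))
  principal-right-into-left (R5 t5) (RD4 _ _) _ (s≤s z≤n) (s≤s z≤n) = identity
  principal-right-into-left (R5 t5) (RD5 _ _) _ (s≤s z≤n) (s≤s z≤n) = identity

  principal-left-into-right : ∀ {g1 s1 p1 d1 g2 s2 p2 d2 rp rs rg} → MShape g1 s1 p1 d1 → MShape g2 s2 p2 d2 →
        rp < p1 → rs < s2 → rg < g2 → Admissible R (g1 + (s1 + rg)) (s1 + rs) p2 (rp + (d1 + d2))
  principal-left-into-right (P _) _ () _ _
  principal-left-into-right (D _) _ () _ _
  principal-left-into-right (RD4 _ _) _ () _ _
  principal-left-into-right (RD5 _ _) _ () _ _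
  principal-left-into-right _ M _ _ ()
  principal-left-into-right _ (N _) _ _ ()
  principal-left-into-right _ (P _) _ _ ()
  principal-left-into-right _ (D _) _ _ ()
  principal-left-into-right _ (R5 _) _ _ ()
  principal-left-into-right _ (RD5 _ _) _ _ ()
  principal-left-into-right _ (R4 _) _ () _
  principal-left-into-right M (RD4 td t4) (s≤s z≤n) (s≤s z≤n) (s≤s z≤n) = rule (RD4 (T-∧-intro td t4))
  principal-left-into-right (N _) (RD4 _ _) (s≤s z≤n) (s≤s z≤n) (s≤s z≤n) = identity
  principal-left-into-right (R4 _) (RD4 _ _) (s≤s z≤n) (s≤s z≤n) (s≤s z≤n) = identity
  principal-left-into-right (R5 _) (RD4 _ _) (s≤s z≤n) (s≤s z≤n) (s≤s z≤n) = identity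

  principal-both : ∀ {g1 s1 p1 d1 g2 s2 p2 d2 rp rs rg rd} → MShape g1 s1 p1 d1 → MShape g2 s2 p2 d2 →
       rp < p1 → rs < s2 → rg < g2 → rd < d1 →
       Admissible R (g1 + (s1 + (rg + rs))) (s1 + rs) p2 (rp + (rd + (p2 + d2)))
  principal-both (P _) _ () _ _ _
  principal-both (D _) _ () _ _ _
  principal-both (RD4 _ _) _ () _ _ _
  principal-both (RD5 _ _) _ () _ _ _
  principal-both M _ _ _ _ ()
  principal-both (N _) _ _ _ _ ()
  principal-both (R4 _) _ _ _ _ ()
  principal-both _ M _ _ () _
  principal-both _ (N _) _ _ () _
  principal-both _ (P _) _ _ () _
  principal-both _ (D _) _ _ () _
  principal-both _ (R5 _) _ _ () _
  principal-both _ (RD5 _ _) _ _ () _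
  principal-both _ (R4 _) _ () _ _
  principal-both (R5 _) (RD4 _ _) (s≤s z≤n) (s≤s z≤n) (s≤s z≤n) (s≤s z≤n) = identity

  closure : Calculus.ShapeClosure R
  closure = record
    { right-into-left           = λ sh1 sh2 → right-into-left (classify sh1) (classify sh2)
    ; left-into-right           = λ sh1 sh2 → left-into-right (classify sh1) (classify sh2)
    ; principal                 = λ sh1 sh2 → principal (classify sh1) (classify sh2)
    ; principal-right-into-left = λ sh1 sh2 → principal-right-into-left (classify sh1) (classify sh2)
    ; principal-left-into-right = λ sh1 sh2 → principal-left-into-right (classify sh1) (classify sh2)
    ; principal-both            = λ sh1 sh2 → principal-both (classify sh1) (classify sh2)
    }

0<+⇒0<⊎0< : ∀ m {n} → 0 < m + n → 0 < m ⊎ 0 < n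
0<+⇒0<⊎0< zero    0<n = inj₂ 0<n
0<+⇒0<⊎0< (suc _) _   = inj₁ (s≤s z≤n)

-- With C, every shape meets the constraints below and, conversely, lengths meeting them
-- give an admissible instance; the six compositions preserve the constraints.
module WithC (hasN hasP hasD has4 has5 : Bool) (5⇒N∧4 : T has5 → T hasN × T has4) where
  R : Rules
  R = calculus (axioms hasN true hasP hasD false has4 has5)

  record Constraints (g s p d : ℕ) : Set where
    field
      p≤1       : p ≤ 1
      boxed⇒4   : 0 < g → T has4
      empty⇒N   : p ≡ 1 → g ≡ 0 → s ≡ 0 → T hasN
      noSucc⇒PD : p ≡ 0 → 0 < s → T (hasP ∨ hasD)
      side⇒5    : 0 < d → T has5
  open Constraints

  constraints : ∀ {g s p d} → Shape R g s p d → Constraints g s p d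
  constraints (M ())
  constraints (N t) = record
    { p≤1 = s≤s z≤n ; boxed⇒4 = λ () ; empty⇒N = λ _ _ _ → t ; noSucc⇒PD = λ () ; side⇒5 = λ () }
  constraints (P t) = record
    { p≤1 = z≤n ; boxed⇒4 = λ () ; empty⇒N = λ () ; noSucc⇒PD = λ _ _ → Equivalence.from T-∨ (inj₁ t) ; side⇒5 = λ () }
  constraints (D t) = record
    { p≤1 = z≤n ; boxed⇒4 = λ () ; empty⇒N = λ () ; noSucc⇒PD = λ _ _ → Equivalence.from T-∨ (inj₂ t) ; side⇒5 = λ () }
  constraints (R4 t) = record
    { p≤1 = s≤s z≤n ; boxed⇒4 = λ _ → t ; empty⇒N = λ _ () ; noSucc⇒PD = λ () ; side⇒5 = λ () }
  constraints (R5 t) = record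
    { p≤1 = s≤s z≤n ; boxed⇒4 = λ () ; empty⇒N = λ _ _ _ → proj₁ (5⇒N∧4 t) ; noSucc⇒PD = λ () ; side⇒5 = λ _ → t }
  constraints (RD4 ())
  constraints (RD5 ())
  constraints (C _) = record
    { p≤1 = s≤s z≤n ; boxed⇒4 = λ () ; empty⇒N = λ _ _ () ; noSucc⇒PD = λ () ; side⇒5 = λ () }
  constraints (CD t) = record
    { p≤1 = z≤n ; boxed⇒4 = λ () ; empty⇒N = λ () ; noSucc⇒PD = λ _ _ → t ; side⇒5 = λ () }
  constraints (C4 t 0<g+s) = record
    { p≤1 = s≤s z≤n ; boxed⇒4 = λ _ → t
    ; empty⇒N = λ { _ refl refl → ⊥-elim (<-irrefl refl 0<g+s) } ; noSucc⇒PD = λ () ; side⇒5 = λ () }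
  constraints (CD4 t) = record
    { p≤1 = z≤n ; boxed⇒4 = λ _ → proj₂ (T-∧-elim (hasP ∨ hasD) t) ; empty⇒N = λ ()
    ; noSucc⇒PD = λ _ _ → proj₁ (T-∧-elim (hasP ∨ hasD) t) ; side⇒5 = λ () }
  constraints (K4 t) = record
    { p≤1 = s≤s z≤n ; boxed⇒4 = λ _ → proj₂ (T-∧-elim hasN t) ; empty⇒N = λ _ _ _ → proj₁ (T-∧-elim hasN t)
    ; noSucc⇒PD = λ () ; side⇒5 = λ () }
  constraints (K45 t) = record
    { p≤1 = s≤s z≤n ; boxed⇒4 = λ _ → proj₁ 4∧5 ; empty⇒N = λ _ _ _ → proj₁ (T-∧-elim hasN t)
    ; noSucc⇒PD = λ () ; side⇒5 = λ _ → proj₂ 4∧5 }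
    where
    4∧5 : T has4 × T has5
    4∧5 = T-∧-elim has4 (proj₂ (T-∧-elim hasN t))
  constraints (KD45 t) = record
    { p≤1 = z≤n ; boxed⇒4 = λ _ → proj₁ 4∧rest ; empty⇒N = λ ()
    ; noSucc⇒PD = λ _ _ → proj₂ 5∧PD ; side⇒5 = λ _ → proj₁ 5∧PD }
    where
    4∧rest : T has4 × T (has5 ∧ (hasP ∨ hasD))
    4∧rest = T-∧-elim has4 (proj₂ (T-∧-elim hasN t))
    5∧PD : T has5 × T (hasP ∨ hasD)
    5∧PD = T-∧-elim has5 (proj₂ 4∧rest)

  admissible : ∀ {g s p d} → p ≤ 1 → (0 < g → T has4) → (p ≡ 1 → g ≡ 0 → s ≡ 0 → T hasN) →
    (p ≡ 0 → 0 < s → T (hasP ∨ hasD)) → (0 < d → p ≡ 1 ⊎ 0 < s → T has5) → Admissible R g s p d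
  admissible {s = zero}  {zero}  _ _ _ _ _ = identity
  admissible {g} {suc s} {zero} {suc d} _ _ _ noSucc⇒PD side⇒5 =
    let t5 = side⇒5 (s≤s z≤n) (inj₂ (s≤s z≤n)) ; N∧4 = 5⇒N∧4 t5 in
    rule (KD45 (T-∧-intro (proj₁ N∧4) (T-∧-intro (proj₂ N∧4) (T-∧-intro t5 (noSucc⇒PD refl (s≤s z≤n))))))
  admissible {zero} {suc s} {zero} {zero} _ _ _ noSucc⇒PD _ = rule (CD (noSucc⇒PD refl (s≤s z≤n)))
  admissible {suc g} {suc s} {zero} {zero} _ boxed⇒4 _ noSucc⇒PD _ =
    rule (CD4 (T-∧-intro (noSucc⇒PD refl (s≤s z≤n)) (boxed⇒4 (s≤s z≤n))))
  admissible {g} {s} {suc zero} {suc d} _ _ _ _ side⇒5 =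
    let t5 = side⇒5 (s≤s z≤n) (inj₁ refl) ; N∧4 = 5⇒N∧4 t5 in
    rule (K45 (T-∧-intro (proj₁ N∧4) (T-∧-intro (proj₂ N∧4) t5)))
  admissible {suc g} {s} {suc zero} {zero} _ boxed⇒4 _ _ _ = rule (C4 (boxed⇒4 (s≤s z≤n)) (s≤s z≤n))
  admissible {zero} {suc s} {suc zero} {zero} _ _ _ _ _ = rule (C tt)
  admissible {zero} {zero} {suc zero} {zero} _ _ empty⇒N _ _ = rule (N (empty⇒N refl refl refl))
  admissible {p = suc (suc _)} (s≤s ()) _ _ _ _

  admissible-with-5 : ∀ {g s p d} → T has5 → p ≤ 1 → (p ≡ 0 → 0 < s → T (hasP ∨ hasD)) → Admissible R g s p d
  admissible-with-5 t5 p≤1 noSucc⇒PD =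
    admissible p≤1 (λ _ → proj₂ (5⇒N∧4 t5)) (λ _ _ _ → proj₁ (5⇒N∧4 t5)) noSucc⇒PD (λ _ _ → t5)

  empty-after-left⇒N : ∀ {g1 s1 p1 d1 rp rg} → Constraints g1 s1 p1 d1 → rp < p1 → g1 + (s1 + rg) ≡ 0 → T hasN
  empty-after-left⇒N {g1} {s1} C1 rp<p1 g1+s1+rg≡0 =
    empty⇒N C1 (≤-antisym (p≤1 C1) (m<n⇒0<n rp<p1))
      (m+n≡0⇒m≡0 g1 g1+s1+rg≡0) (m+n≡0⇒m≡0 s1 (m+n≡0⇒n≡0 g1 g1+s1+rg≡0))

  ≯0 : ∀ {rp p1} → rp < p1 → p1 ≤ 1 → ¬ 0 < rp
  ≯0 rp<p1 p1≤1 0<rp = <-irrefl refl (<-≤-trans (≤-<-trans 0<rp rp<p1) p1≤1)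

  closure : Calculus.ShapeClosure R
  closure = record
    { right-into-left = λ sh1 _ rd<d1 _ _ _ →
        let C1 = constraints sh1 in
        admissible-with-5 (side⇒5 C1 (m<n⇒0<n rd<d1)) (p≤1 C1) (noSucc⇒PD C1)
    ; left-into-right = λ {_} {_} {_} {_} {_} {_} {_} {_} {rp} {rd} sh1 sh2 rp<p1 rd≤d1 rg<g2 →
        let C1 = constraints sh1 ; C2 = constraints sh2 in
        admissible (p≤1 C2) (λ _ → boxed⇒4 C2 (m<n⇒0<n rg<g2))
          (λ _ g1+s1+rg≡0 _ → empty-after-left⇒N C1 rp<p1 g1+s1+rg≡0)
          (noSucc⇒PD C2)
          (λ 0<rp+rd+d2 _ → [ (⊥-elim ∘ ≯0 rp<p1 (p≤1 C1))
                             , (λ 0<rd+d2 → [ (λ 0<rd → side⇒5 C1 (≤-trans 0<rd rd≤d1)) , side⇒5 C2 ]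
                                              (0<+⇒0<⊎0< rd 0<rd+d2)) ]
                             (0<+⇒0<⊎0< rp 0<rp+rd+d2))
    ; principal = λ {g1} {s1} {_} {d1} sh1 sh2 0<p1 rs<s2 →
        let C1 = constraints sh1 ; C2 = constraints sh2 in
        admissible (p≤1 C2) (λ 0<g1+g2 → [ boxed⇒4 C1 , boxed⇒4 C2 ] (0<+⇒0<⊎0< g1 0<g1+g2))
          (λ _ g1+g2≡0 s1+rs≡0 → empty⇒N C1 (≤-antisym (p≤1 C1) 0<p1) (m+n≡0⇒m≡0 g1 g1+g2≡0) (m+n≡0⇒m≡0 s1 s1+rs≡0))
          (λ p2≡0 _ → noSucc⇒PD C2 p2≡0 (m<n⇒0<n rs<s2))
          (λ 0<d1+d2 _ → [ side⇒5 C1 , side⇒5 C2 ] (0<+⇒0<⊎0< d1 0<d1+d2))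
    ; principal-right-into-left = λ sh1 sh2 _ rs<s2 rd<d1 →
        let C1 = constraints sh1 ; C2 = constraints sh2 in
        admissible-with-5 (side⇒5 C1 (m<n⇒0<n rd<d1)) (p≤1 C2) (λ p2≡0 _ → noSucc⇒PD C2 p2≡0 (m<n⇒0<n rs<s2))
    ; principal-left-into-right = λ {_} {_} {_} {d1} {_} {_} {_} {_} {rp} sh1 sh2 rp<p1 rs<s2 rg<g2 →
        let C1 = constraints sh1 ; C2 = constraints sh2 in
        admissible (p≤1 C2) (λ _ → boxed⇒4 C2 (m<n⇒0<n rg<g2))
          (λ _ g1+s1+rg≡0 _ → empty-after-left⇒N C1 rp<p1 g1+s1+rg≡0)
          (λ p2≡0 _ → noSucc⇒PD C2 p2≡0 (m<n⇒0<n rs<s2))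
          (λ 0<rp+d1+d2 _ → [ (⊥-elim ∘ ≯0 rp<p1 (p≤1 C1))
                             , (λ 0<d1+d2 → [ side⇒5 C1 , side⇒5 C2 ] (0<+⇒0<⊎0< d1 0<d1+d2)) ]
                             (0<+⇒0<⊎0< rp 0<rp+d1+d2))
    ; principal-both = λ sh1 sh2 _ rs<s2 _ rd<d1 →
        let C1 = constraints sh1 ; C2 = constraints sh2 in
        admissible-with-5 (side⇒5 C1 (m<n⇒0<n rd<d1)) (p≤1 C2) (λ p2≡0 _ → noSucc⇒PD C2 p2≡0 (m<n⇒0<n rs<s2))
    }

no-T : ∀ L → ¬ T (rT (G L))
no-T (M𝒜 _ false _ _ _) ()
no-T (M𝒜 _ true _ _ _) ()
no-T M5 ()
no-T MP5 ()
no-T M45 ()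
no-T MP45 ()
no-T MD45 ()
no-T K45 ()
no-T KD45 ()

closure : ∀ L → Calculus.ShapeClosure (G L)
closure (M𝒜 n false p d f4) = WithoutC.closure n p d f4 false (λ _ ())
closure (M𝒜 n true p d f4)  = WithC.closure n p d f4 false (λ ())
closure M5   = WithoutC.closure false false false false true (λ ())
closure MP5  = WithoutC.closure false true false false true (λ ())
closure M45  = WithoutC.closure false false false true true (λ ())
closure MP45 = WithoutC.closure false true false true true (λ ())
closure MD45 = WithoutC.closure false false true true true (λ _ _ → tt)
closure K45  = WithC.closure true false false true true (λ _ → tt , tt)
closure KD45 = WithC.closure true false true true true (λ _ → tt , tt)

mainTheorem15 : (L : Logic) (S : Sequent) →
    Der (G L) true S → Der (G L) false S
mainTheorem15 L S d = toDer (G L) (fromDer (G L) (closure L) (no-T L) d)
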